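{- Let $p\ge 7$ be a prime. Then $$\sum_{k=1}^{p-1}\frac{H_k}{k^2}\equiv \sum_{k=1}^{p-1}\frac{H_k^2}{k}\equiv -\frac{3}{p^2}\sum_{k=1}^{p-1}\frac{1}{k}\equiv\frac{3}{2p}\sum_{k=1}^{p-1}\frac{1}{k^2}\pmod{p^2}.$$
   Context: For a positive integer $n$, $H_n=\sum_{k=1}^{n}\frac1k$ is the $n$th harmonic number. Congruences modulo a prime power are understood in the ring of rational numbers whose denominators are not divisible by $p$: $a/b\equiv c/d \pmod{p^r}$ means $p^r \mid (ad-bc)$ when $p\nmid bd$, i.e. $p^r$ divides the numerator of $a/b-c/d$. (It is part of the claim that $-\frac{3}{p^2}\sum_{k=1}^{p-1}\frac1k$ and $\frac{3}{2p}\sum_{k=1}^{p-1}\frac1{k^2}$ are $p$-integral.) -}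

module Defs where

open import Data.Nat using (ℕ; zero; suc; _^_)
open import Data.Nat.Divisibility using (_∣_)
open import Data.Nat.Properties using (m^n≢0)
open import Data.Integer using (ℤ; +_)
import Data.Integer as ℤ
open import Data.Rational using (ℚ; _/_; _+_; _-_; _*_; ↥_; ↧ₙ_)
open import Data.Product using (_×_)
open import Relation.Nullary using (¬_)

sumFrom1 : ℕ → (ℕ → ℚ) → ℚ
sumFrom1 zero    f = Data.Rational.0ℚ
sumFrom1 (suc n) f = sumFrom1 n f + f (suc n)

-- 1 / k^e for k ≥ 1 (value for k = 0 irrelevant: taken as 1/1)
inv : ℕ → ℕ → ℚ
inv zero    e = + 1 / 1
inv (suc j) e = _/_ (+ 1) (suc j ^ e) {{m^n≢0 (suc j) e}}

H : ℕ → ℚ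
H n = sumFrom1 n (λ k → inv k 1)

-- p-adic congruence in Z_(p): a ≡ b (mod p^r) iff p ∤ den a, p ∤ den b,
-- and p^r divides the numerator of a - b.
_≡_[mod_^_] : ℚ → ℚ → ℕ → ℕ → Set
a ≡ b [mod p ^ r ] =
  (¬ (p ∣ ↧ₙ a)) × (¬ (p ∣ ↧ₙ b)) × ((p ^ r) ∣ ℤ.∣ ↥ (a - b) ∣)

-- Write c_k = (-1)^k C(p-1,k) = Π_{j ≤ k} (1 - p/j) ≡ 1 - p H_k + p² e₂(k) (mod p³).
-- The binomial transform Σ_k (-1)^(k-1) C(N,k) f(k) sends 1/k^r to the
-- multiple harmonic star sum H⋆_r(N), so for p-integral f the congruence c_k ≡ 1 (mod p) turns the
-- Newton identities between star sums and power sums into p | H_{p-1}, H⁽²⁾_{p-1}, H⁽⁴⁾_{p-1};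
-- pairing k with p - k then gives p² | H⁽³⁾_{p-1} and p⁴ | 2H_{p-1} + pH⁽²⁾_{p-1}.
-- With f = 1/k² the full expansion of c_k yields 2p Σ H_k/k² ≡ 3H⁽²⁾_{p-1} (mod p³), which is
-- the first sum ≡ the fourth.  The first ≡ the second because their difference is
-- (H⁽³⁾_{p-1} - H_{p-1}³)/3, and the third ≡ the fourth is p⁴ | 2H_{p-1} + pH⁽²⁾_{p-1}.

module Submission where

open import Data.Nat using (ℕ; suc; _≤_)
open import Data.Nat.Primality using (Prime)

module Arithmetic where

  open import Defs
  open import Data.Nat as ℕ using (ℕ; zero; suc; z<s)
  import Data.Nat.Properties as ℕ
  open import Data.Integer as ℤ using (ℤ; +_)
  import Data.Integer.Properties as ℤ
  open import Data.Rational as ℚ using (ℚ; 0ℚ; 1ℚ; _+_; _*_; _-_; -_; _/_; fromℚᵘ)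
  import Data.Rational.Properties as ℚ
  import Data.Rational.Unnormalised as ℚᵘ
  import Data.Rational.Unnormalised.Properties as ℚᵘ
  open import Relation.Nullary.Decidable.Core using (dec⇒maybe)
  open import Algebra.Properties.Group ℚ.+-0-group using (x∙y⁻¹≈ε⇒x≈y)
  open import Relation.Binary.PropositionalEquality
  import Tactic.RingSolver.Core.AlmostCommutativeRing as ACR
  open import Tactic.RingSolver using (solve-∀)

  ℚ-ring : ACR.AlmostCommutativeRing _ _
  ℚ-ring = ACR.fromCommutativeRing ℚ.+-*-commutativeRing (λ x → dec⇒maybe (0ℚ ℚ.≟ x))

  ι : ℕ → ℚ
  ι n = + n / 1

  ιℤ : ℤ → ℚ
  ιℤ z = z / 1

  fromℚᵘ-homo-+ : ∀ a b → fromℚᵘ (a ℚᵘ.+ b) ≡ fromℚᵘ a + fromℚᵘ b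
  fromℚᵘ-homo-+ a b = ℚ.toℚᵘ-injective (ℚᵘ.≃-trans (ℚ.toℚᵘ-fromℚᵘ _)
    (ℚᵘ.≃-sym (ℚᵘ.≃-trans (ℚ.toℚᵘ-homo-+ (fromℚᵘ a) (fromℚᵘ b))
      (ℚᵘ.+-cong (ℚ.toℚᵘ-fromℚᵘ a) (ℚ.toℚᵘ-fromℚᵘ b)))))

  fromℚᵘ-homo-* : ∀ a b → fromℚᵘ (a ℚᵘ.* b) ≡ fromℚᵘ a * fromℚᵘ b
  fromℚᵘ-homo-* a b = ℚ.toℚᵘ-injective (ℚᵘ.≃-trans (ℚ.toℚᵘ-fromℚᵘ _)
    (ℚᵘ.≃-sym (ℚᵘ.≃-trans (ℚ.toℚᵘ-homo-* (fromℚᵘ a) (fromℚᵘ b))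
      (ℚᵘ.*-cong (ℚ.toℚᵘ-fromℚᵘ a) (ℚ.toℚᵘ-fromℚᵘ b)))))

  ιℤ-homo-+ : ∀ a b → ιℤ (a ℤ.+ b) ≡ ιℤ a + ιℤ b
  ιℤ-homo-+ a b = trans (ℚ.fromℚᵘ-cong {ℚᵘ.mkℚᵘ (a ℤ.+ b) 0} {ℚᵘ.mkℚᵘ a 0 ℚᵘ.+ ℚᵘ.mkℚᵘ b 0} (ℚᵘ.*≡* scaled))
    (fromℚᵘ-homo-+ (ℚᵘ.mkℚᵘ a 0) (ℚᵘ.mkℚᵘ b 0))
    where
    scaled : (a ℤ.+ b) ℤ.* + 1 ≡ (a ℤ.* + 1 ℤ.+ b ℤ.* + 1) ℤ.* + 1
    scaled = cong (ℤ._* + 1) (sym (cong₂ ℤ._+_ (ℤ.*-identityʳ a) (ℤ.*-identityʳ b)))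

  ιℤ-homo-* : ∀ a b → ιℤ (a ℤ.* b) ≡ ιℤ a * ιℤ b
  ιℤ-homo-* a b = fromℚᵘ-homo-* (ℚᵘ.mkℚᵘ a 0) (ℚᵘ.mkℚᵘ b 0)

  ιℤ-homo-neg : ∀ a → ιℤ (ℤ.- a) ≡ - ιℤ a
  ιℤ-homo-neg a = ℚ.toℚᵘ-injective (ℚᵘ.≃-trans (ℚ.toℚᵘ-fromℚᵘ _)
    (ℚᵘ.≃-sym (ℚᵘ.≃-trans (ℚ.toℚᵘ-homo‿- (ιℤ a)) (ℚᵘ.-‿cong (ℚ.toℚᵘ-fromℚᵘ (ℚᵘ.mkℚᵘ a 0))))))

  ι-homo-+ : ∀ a b → ι (a ℕ.+ b) ≡ ι a + ι b
  ι-homo-+ a b = trans (cong ιℤ (ℤ.pos-+ a b)) (ιℤ-homo-+ (+ a) (+ b))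

  ι-homo-* : ∀ a b → ι (a ℕ.* b) ≡ ι a * ι b
  ι-homo-* a b = trans (cong ιℤ (ℤ.pos-* a b)) (ιℤ-homo-* (+ a) (+ b))

  recip : ℕ → ℚ
  recip k = inv k 1

  1/[1+d]*[1+d]≡1 : ∀ d → (+ 1 / suc d) * ι (suc d) ≡ 1ℚ
  1/[1+d]*[1+d]≡1 d = trans (sym (fromℚᵘ-homo-* (ℚᵘ.mkℚᵘ (+ 1) d) (ℚᵘ.mkℚᵘ (+ suc d) 0)))
    (ℚ.fromℚᵘ-cong {ℚᵘ.mkℚᵘ (+ 1) d ℚᵘ.* ℚᵘ.mkℚᵘ (+ suc d) 0} {ℚᵘ.mkℚᵘ (+ 1) 0} (ℚᵘ.*≡*
      (trans (ℤ.*-identityʳ _) (trans (ℤ.*-identityˡ _) (sym (trans (ℤ.*-identityˡ _) (cong +_ (ℕ.*-identityʳ (suc d)))))))))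

  recip-inverseˡ : ∀ k → 0 ℕ.< k → recip k * ι k ≡ 1ℚ
  recip-inverseˡ (suc j) _ = trans (cong (λ d → recip (suc j) * ι (suc d)) (sym (ℕ.*-identityʳ j))) (1/[1+d]*[1+d]≡1 (j ℕ.* 1))

  *-inverse-unique : ∀ {a b c} → a * c ≡ 1ℚ → b * c ≡ 1ℚ → a ≡ b
  *-inverse-unique {a} {b} {c} ac≡1 bc≡1 = begin
    a             ≡⟨ ℚ.*-identityʳ a ⟨
    a * 1ℚ        ≡⟨ cong (a *_) bc≡1 ⟨
    a * (b * c)   ≡⟨ swap a b c ⟩
    b * (a * c)   ≡⟨ cong (b *_) ac≡1 ⟩
    b * 1ℚ        ≡⟨ ℚ.*-identityʳ b ⟩
    b             ∎
    where
    open ≡-Reasoning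
    swap : ∀ a b c → a * (b * c) ≡ b * (a * c)
    swap = solve-∀ ℚ-ring

  inv-sq : ∀ k → inv k 2 ≡ recip k * recip k
  inv-sq zero    = refl
  inv-sq (suc j) = *-inverse-unique (1/[1+d]*[1+d]≡1 (j ℕ.* 1 ℕ.+ j ℕ.* suc (j ℕ.* 1))) recip²-inverse
    where
    open ≡-Reasoning
    x = recip (suc j)
    interchange : ∀ a b → (a * a) * (b * b) ≡ (a * b) * (a * b)
    interchange = solve-∀ ℚ-ring
    recip²-inverse : x * x * ι (suc j ℕ.^ 2) ≡ 1ℚ
    recip²-inverse = begin
      x * x * ι (suc j ℕ.^ 2)
        ≡⟨ cong (x * x *_) (trans (ι-homo-* (suc j) (suc j ℕ.* 1)) (cong (λ m → ι (suc j) * ι m) (ℕ.*-identityʳ (suc j)))) ⟩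
      x * x * (ι (suc j) * ι (suc j))   ≡⟨ interchange x (ι (suc j)) ⟩
      (x * ι (suc j)) * (x * ι (suc j)) ≡⟨ cong₂ _*_ (recip-inverseˡ (suc j) z<s) (recip-inverseˡ (suc j) z<s) ⟩
      1ℚ * 1ℚ                           ∎

  scaled-difference-zero : ∀ k {a b} → a ≡ b → k * (a - b) ≡ 0ℚ
  scaled-difference-zero k {a} refl = trans (cong (k *_) (ℚ.+-inverseʳ a)) (ℚ.*-zeroʳ k)

  linear-combination₁ : ∀ {lhs rhs a₁ b₁} k₁ → lhs - rhs ≡ k₁ * (a₁ - b₁) → a₁ ≡ b₁ → lhs ≡ rhs
  linear-combination₁ k₁ ring-identity e₁ = x∙y⁻¹≈ε⇒x≈y _ _ (trans ring-identity (scaled-difference-zero k₁ e₁))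

  linear-combination₂ : ∀ {lhs rhs a₁ b₁ a₂ b₂} k₁ k₂ →
    lhs - rhs ≡ k₁ * (a₁ - b₁) + k₂ * (a₂ - b₂) → a₁ ≡ b₁ → a₂ ≡ b₂ → lhs ≡ rhs
  linear-combination₂ k₁ k₂ ring-identity e₁ e₂ = x∙y⁻¹≈ε⇒x≈y _ _ (trans ring-identity
    (cong₂ _+_ (scaled-difference-zero k₁ e₁) (scaled-difference-zero k₂ e₂)))

  linear-combination₃ : ∀ {lhs rhs a₁ b₁ a₂ b₂ a₃ b₃} k₁ k₂ k₃ →
    lhs - rhs ≡ k₁ * (a₁ - b₁) + k₂ * (a₂ - b₂) + k₃ * (a₃ - b₃) → a₁ ≡ b₁ → a₂ ≡ b₂ → a₃ ≡ b₃ → lhs ≡ rhs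
  linear-combination₃ k₁ k₂ k₃ ring-identity e₁ e₂ e₃ = x∙y⁻¹≈ε⇒x≈y _ _ (trans ring-identity
    (cong₂ _+_ (cong₂ _+_ (scaled-difference-zero k₁ e₁) (scaled-difference-zero k₂ e₂)) (scaled-difference-zero k₃ e₃)))

  sum-cong : ∀ N {f g} → (∀ k → 0 ℕ.< k → k ℕ.≤ N → f k ≡ g k) → sumFrom1 N f ≡ sumFrom1 N g
  sum-cong zero    f≡g = refl
  sum-cong (suc N) f≡g = cong₂ _+_ (sum-cong N (λ k 0<k k≤N → f≡g k 0<k (ℕ.m≤n⇒m≤1+n k≤N))) (f≡g (suc N) z<s ℕ.≤-refl)

  sum-zero : ∀ N → sumFrom1 N (λ _ → 0ℚ) ≡ 0ℚ
  sum-zero zero    = refl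
  sum-zero (suc N) = trans (ℚ.+-identityʳ _) (sum-zero N)

  sum-distrib-+ : ∀ N f g → sumFrom1 N (λ k → f k + g k) ≡ sumFrom1 N f + sumFrom1 N g
  sum-distrib-+ zero    f g = refl
  sum-distrib-+ (suc N) f g = trans (cong (_+ (f (suc N) + g (suc N))) (sum-distrib-+ N f g))
    (interchange (sumFrom1 N f) (sumFrom1 N g) (f (suc N)) (g (suc N)))
    where
    interchange : ∀ a b c d → (a + b) + (c + d) ≡ (a + c) + (b + d)
    interchange = solve-∀ ℚ-ring

  sum-distrib-neg : ∀ N f → sumFrom1 N (λ k → - f k) ≡ - sumFrom1 N f
  sum-distrib-neg zero    f = refl
  sum-distrib-neg (suc N) f = trans (cong (_+ - f (suc N)) (sum-distrib-neg N f)) (sym (ℚ.neg-distrib-+ (sumFrom1 N f) (f (suc N))))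

  sum-distrib-- : ∀ N f g → sumFrom1 N (λ k → f k - g k) ≡ sumFrom1 N f - sumFrom1 N g
  sum-distrib-- N f g = trans (sum-distrib-+ N f (λ k → - g k)) (cong (λ t → sumFrom1 N f + t) (sum-distrib-neg N g))

  *-distribˡ-sum : ∀ N c f → sumFrom1 N (λ k → c * f k) ≡ c * sumFrom1 N f
  *-distribˡ-sum zero    c f = sym (ℚ.*-zeroʳ c)
  *-distribˡ-sum (suc N) c f = trans (cong (_+ (c * f (suc N))) (*-distribˡ-sum N c f))
    (sym (ℚ.*-distribˡ-+ c (sumFrom1 N f) (f (suc N))))

  sum-unfoldˡ : ∀ N f → sumFrom1 (suc N) f ≡ f 1 + sumFrom1 N (λ k → f (suc k))
  sum-unfoldˡ zero    f = ℚ.+-comm 0ℚ (f 1)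
  sum-unfoldˡ (suc N) f = trans (cong (_+ f (suc (suc N))) (sum-unfoldˡ N f))
    (ℚ.+-assoc (f 1) (sumFrom1 N (λ k → f (suc k))) (f (suc (suc N))))

  sum-reverse : ∀ N f → sumFrom1 N f ≡ sumFrom1 N (λ k → f (suc N ℕ.∸ k))
  sum-reverse zero    f = refl
  sum-reverse (suc N) f = trans (cong (_+ f (suc N)) (sum-reverse N f))
    (trans (ℚ.+-comm (sumFrom1 N (λ k → f (suc N ℕ.∸ k))) (f (suc N))) (sym (sum-unfoldˡ N (λ k → f (suc (suc N) ℕ.∸ k)))))

module BinomialSums where

  open Arithmetic
  open import Defs
  open import Data.Nat as ℕ using (ℕ; zero; suc; z<s)
  import Data.Nat.Properties as ℕ
  open import Data.Nat.Combinatorics using (_C_; nC1≡n; nCk+nC[k+1]≡[n+1]C[k+1])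
  open import Data.Nat.Combinatorics.Specification using (k>n⇒nCk≡0)
  import Data.Nat.Tactic.RingSolver as ℕ-Solver
  open import Data.Rational as ℚ using (ℚ; 0ℚ; 1ℚ; _+_; _*_; _-_; -_)
  import Data.Rational.Properties as ℚ
  open import Relation.Binary.PropositionalEquality
  open import Tactic.RingSolver using (solve-∀)

  [k+1]*[n+1]C[k+1]≡[n+1]*nCk : ∀ n k → suc k ℕ.* (suc n C suc k) ≡ suc n ℕ.* (n C k)
  [k+1]*[n+1]C[k+1]≡[n+1]*nCk zero    zero    = refl
  [k+1]*[n+1]C[k+1]≡[n+1]*nCk zero    (suc k) = ℕ.*-zeroʳ (suc (suc k))
  [k+1]*[n+1]C[k+1]≡[n+1]*nCk (suc n) zero    =
    trans (ℕ.*-identityˡ _) (trans (nC1≡n (suc (suc n))) (sym (ℕ.*-identityʳ _)))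
  [k+1]*[n+1]C[k+1]≡[n+1]*nCk (suc n) (suc k) = begin
    suc (suc k) ℕ.* (suc (suc n) C suc (suc k))
      ≡⟨ cong (suc (suc k) ℕ.*_) (nCk+nC[k+1]≡[n+1]C[k+1] (suc n) (suc k)) ⟨
    suc (suc k) ℕ.* (suc n C suc k ℕ.+ suc n C suc (suc k))
      ≡⟨ expand k (suc n C suc k) (suc n C suc (suc k)) ⟩
    suc k ℕ.* (suc n C suc k) ℕ.+ suc n C suc k ℕ.+ suc (suc k) ℕ.* (suc n C suc (suc k))
      ≡⟨ cong₂ (λ x y → x ℕ.+ suc n C suc k ℕ.+ y) ([k+1]*[n+1]C[k+1]≡[n+1]*nCk n k) ([k+1]*[n+1]C[k+1]≡[n+1]*nCk n (suc k)) ⟩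
    suc n ℕ.* (n C k) ℕ.+ suc n C suc k ℕ.+ suc n ℕ.* (n C suc k)
      ≡⟨ cong (λ x → suc n ℕ.* (n C k) ℕ.+ x ℕ.+ suc n ℕ.* (n C suc k)) (nCk+nC[k+1]≡[n+1]C[k+1] n k) ⟨
    suc n ℕ.* (n C k) ℕ.+ (n C k ℕ.+ n C suc k) ℕ.+ suc n ℕ.* (n C suc k)
      ≡⟨ collect n (n C k) (n C suc k) ⟩
    suc (suc n) ℕ.* (n C k ℕ.+ n C suc k)
      ≡⟨ cong (suc (suc n) ℕ.*_) (nCk+nC[k+1]≡[n+1]C[k+1] n k) ⟩
    suc (suc n) ℕ.* (suc n C suc k) ∎
    where
    open ≡-Reasoning
    expand : ∀ k a b → suc (suc k) ℕ.* (a ℕ.+ b) ≡ suc k ℕ.* a ℕ.+ a ℕ.+ suc (suc k) ℕ.* b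
    expand = ℕ-Solver.solve-∀
    collect : ∀ n a b → suc n ℕ.* a ℕ.+ (a ℕ.+ b) ℕ.+ suc n ℕ.* b ≡ suc (suc n) ℕ.* (a ℕ.+ b)
    collect = ℕ-Solver.solve-∀

  nCk/[k+1]≡[n+1]C[k+1]/[n+1] : ∀ n k → ι (n C k) * recip (suc k) ≡ recip (suc n) * ι (suc n C suc k)
  nCk/[k+1]≡[n+1]C[k+1]/[n+1] n k = linear-combination₃ (- (c * x)) (y * c′) (- (x * y)) (ring-identity c c′ x y (ι (suc k)) (ι (suc n)))
    (recip-inverseˡ (suc n) z<s) (recip-inverseˡ (suc k) z<s) absorption
    where
    c = ι (n C k)
    c′ = ι (suc n C suc k)
    x = recip (suc k)
    y = recip (suc n)
    ring-identity : ∀ c c′ x y K N → c * x - y * c′ ≡ - (c * x) * (y * N - 1ℚ) + y * c′ * (x * K - 1ℚ) + - (x * y) * (K * c′ - N * c)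
    ring-identity = solve-∀ ℚ-ring
    absorption : ι (suc k) * c′ ≡ ι (suc n) * c
    absorption = trans (sym (ι-homo-* (suc k) (suc n C suc k)))
      (trans (cong ι ([k+1]*[n+1]C[k+1]≡[n+1]*nCk n k)) (ι-homo-* (suc n) (n C k)))

  -- altSign k = (-1)^(k+1), so binomialSum N f = Σ_{k=1}^N (-1)^(k-1) C(N,k) f(k).
  altSign : ℕ → ℚ
  altSign zero    = - 1ℚ
  altSign (suc k) = - altSign k

  binomialSum : ℕ → (ℕ → ℚ) → ℚ
  binomialSum N f = sumFrom1 N (λ k → altSign k * ι (N C k) * f k)

  shiftedBinomialSum : ℕ → (ℕ → ℚ) → ℚ
  shiftedBinomialSum N f = sumFrom1 (suc N) (λ k → altSign k * ι (N C ℕ.pred k) * f k)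

  binomialSum-cong : ∀ N {f g} → (∀ k → f k ≡ g k) → binomialSum N f ≡ binomialSum N g
  binomialSum-cong N f≡g = sum-cong N (λ k _ _ → cong (altSign k * ι (N C k) *_) (f≡g k))

  binomialSum-suc : ∀ N f → binomialSum (suc N) f ≡ binomialSum N f + shiftedBinomialSum N f
  binomialSum-suc N f = begin
    binomialSum (suc N) f                             ≡⟨ sum-cong (suc N) pascal ⟩
    sumFrom1 (suc N) (λ k → a k + b k)                ≡⟨ sum-distrib-+ (suc N) a b ⟩
    (binomialSum N f + a (suc N)) + shiftedBinomialSum N f
      ≡⟨ cong (λ t → (binomialSum N f + t) + shiftedBinomialSum N f) top-term-vanishes ⟩
    (binomialSum N f + 0ℚ) + shiftedBinomialSum N f   ≡⟨ cong (_+ shiftedBinomialSum N f) (ℚ.+-identityʳ (binomialSum N f)) ⟩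
    binomialSum N f + shiftedBinomialSum N f          ∎
    where
    open ≡-Reasoning
    a b : ℕ → ℚ
    a k = altSign k * ι (N C k) * f k
    b k = altSign k * ι (N C ℕ.pred k) * f k
    split : ∀ s x y f → s * (x + y) * f ≡ s * y * f + s * x * f
    split = solve-∀ ℚ-ring
    pascal : ∀ k → 0 ℕ.< k → k ℕ.≤ suc N → altSign k * ι (suc N C k) * f k ≡ a k + b k
    pascal (suc k) _ _ = trans (cong (λ t → altSign (suc k) * ι t * f (suc k)) (sym (nCk+nC[k+1]≡[n+1]C[k+1] N k)))
      (trans (cong (λ t → altSign (suc k) * t * f (suc k)) (ι-homo-+ (N C k) (N C suc k)))
        (split (altSign (suc k)) (ι (N C k)) (ι (N C suc k)) (f (suc k))))
    annihilate : ∀ a b → a * 0ℚ * b ≡ 0ℚ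
    annihilate = solve-∀ ℚ-ring
    top-term-vanishes : a (suc N) ≡ 0ℚ
    top-term-vanishes = trans (cong (λ t → altSign (suc N) * ι t * f (suc N)) (k>n⇒nCk≡0 (ℕ.n<1+n N)))
      (annihilate (altSign (suc N)) (f (suc N)))

  shiftedBinomialSum-*recip : ∀ N g → shiftedBinomialSum N (λ k → g k * recip k) ≡ binomialSum (suc N) g * recip (suc N)
  shiftedBinomialSum-*recip N g = trans (sum-cong (suc N) termwise)
    (trans (*-distribˡ-sum (suc N) (recip (suc N)) _) (ℚ.*-comm (recip (suc N)) (binomialSum (suc N) g)))
    where
    rearrange : ∀ s c g x → s * c * (g * x) ≡ s * g * (c * x)
    rearrange = solve-∀ ℚ-ring
    rearrange′ : ∀ s g y c′ → s * g * (y * c′) ≡ y * (s * c′ * g)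
    rearrange′ = solve-∀ ℚ-ring
    termwise : ∀ k → 0 ℕ.< k → k ℕ.≤ suc N →
      altSign k * ι (N C ℕ.pred k) * (g k * recip k) ≡ recip (suc N) * (altSign k * ι (suc N C k) * g k)
    termwise (suc k) _ _ = trans (rearrange (altSign (suc k)) (ι (N C k)) (g (suc k)) (recip (suc k)))
      (trans (cong (altSign (suc k) * g (suc k) *_) (nCk/[k+1]≡[n+1]C[k+1]/[n+1] N k))
        (rearrange′ (altSign (suc k)) (g (suc k)) (recip (suc N)) (ι (suc N C suc k))))

  shiftedBinomialSum-partialSum : ∀ N h →
    shiftedBinomialSum N (λ k → sumFrom1 k h) ≡ - binomialSum N (λ k → sumFrom1 k h) + shiftedBinomialSum N h
  shiftedBinomialSum-partialSum N h = begin
    shiftedBinomialSum N G                                   ≡⟨ sum-cong (suc N) last-term-split ⟩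
    sumFrom1 (suc N) (λ k → a k + b k)                       ≡⟨ sum-distrib-+ (suc N) a b ⟩
    sumFrom1 (suc N) a + shiftedBinomialSum N h              ≡⟨ cong (_+ shiftedBinomialSum N h) (sum-unfoldˡ N a) ⟩
    (a 1 + sumFrom1 N (λ k → a (suc k))) + shiftedBinomialSum N h
      ≡⟨ cong₂ (λ s t → (s + t) + shiftedBinomialSum N h) (annihilate (altSign 1) (ι (N C 0)))
               (trans (sum-cong N (λ k _ _ → sign-flip (altSign k) (ι (N C k)) (G k))) (sum-distrib-neg N (λ k → altSign k * ι (N C k) * G k))) ⟩
    (0ℚ + - binomialSum N G) + shiftedBinomialSum N h        ≡⟨ cong (_+ shiftedBinomialSum N h) (ℚ.+-identityˡ (- binomialSum N G)) ⟩
    - binomialSum N G + shiftedBinomialSum N h               ∎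
    where
    open ≡-Reasoning
    G a b : ℕ → ℚ
    G k = sumFrom1 k h
    a k = altSign k * ι (N C ℕ.pred k) * G (ℕ.pred k)
    b k = altSign k * ι (N C ℕ.pred k) * h k
    distrib : ∀ s c x y → s * c * (x + y) ≡ s * c * x + s * c * y
    distrib = solve-∀ ℚ-ring
    last-term-split : ∀ k → 0 ℕ.< k → k ℕ.≤ suc N → altSign k * ι (N C ℕ.pred k) * G k ≡ a k + b k
    last-term-split (suc k) _ _ = distrib (altSign (suc k)) (ι (N C k)) (G k) (h (suc k))
    annihilate : ∀ a b → a * b * 0ℚ ≡ 0ℚ
    annihilate = solve-∀ ℚ-ring
    sign-flip : ∀ s c g → (- s) * c * g ≡ - (s * c * g)
    sign-flip = solve-∀ ℚ-ring

  binomialSum-*recip : ∀ N g → binomialSum N (λ k → g k * recip k) ≡ sumFrom1 N (λ m → binomialSum m g * recip m)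
  binomialSum-*recip zero    g = refl
  binomialSum-*recip (suc N) g = trans (binomialSum-suc N (λ k → g k * recip k))
    (cong₂ _+_ (binomialSum-*recip N g) (shiftedBinomialSum-*recip N g))

  binomialSum-partialSum : ∀ m g → binomialSum m (λ k → sumFrom1 k (λ i → g i * recip i)) ≡ binomialSum m g * recip m
  binomialSum-partialSum zero    g = sym (ℚ.*-zeroˡ (recip 0))
  binomialSum-partialSum (suc N) g = begin
    binomialSum (suc N) G                                                 ≡⟨ binomialSum-suc N G ⟩
    binomialSum N G + shiftedBinomialSum N G                              ≡⟨ cong (λ t → binomialSum N G + t) (shiftedBinomialSum-partialSum N (λ i → g i * recip i)) ⟩
    binomialSum N G + (- binomialSum N G + shiftedBinomialSum N (λ i → g i * recip i)) ≡⟨ cancel (binomialSum N G) _ ⟩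
    shiftedBinomialSum N (λ i → g i * recip i)                            ≡⟨ shiftedBinomialSum-*recip N g ⟩
    binomialSum (suc N) g * recip (suc N)                                 ∎
    where
    open ≡-Reasoning
    G : ℕ → ℚ
    G k = sumFrom1 k (λ i → g i * recip i)
    cancel : ∀ a b → a + (- a + b) ≡ b
    cancel = solve-∀ ℚ-ring

  binomialSum-one : ∀ N → binomialSum (suc N) (λ _ → 1ℚ) ≡ 1ℚ
  binomialSum-one N = begin
    binomialSum (suc N) (λ _ → 1ℚ)                        ≡⟨ sum-cong (suc N) one-as-partialSum ⟩
    binomialSum (suc N) G                                 ≡⟨ binomialSum-suc N G ⟩
    binomialSum N G + shiftedBinomialSum N G              ≡⟨ cong (λ t → binomialSum N G + t) (shiftedBinomialSum-partialSum N δ₁) ⟩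
    binomialSum N G + (- binomialSum N G + shiftedBinomialSum N δ₁) ≡⟨ cancel (binomialSum N G) (shiftedBinomialSum N δ₁) ⟩
    shiftedBinomialSum N δ₁                               ≡⟨ sum-unfoldˡ N _ ⟩
    altSign 1 * ι (N C 0) * δ₁ 1 + sumFrom1 N (λ k → altSign (suc k) * ι (N C k) * δ₁ (suc k))
      ≡⟨ cong (λ t → altSign 1 * ι (N C 0) * δ₁ 1 + t) (trans (sum-cong N δ₁-vanishes) (sum-zero N)) ⟩
    1ℚ                                                    ∎
    where
    open ≡-Reasoning
    δ₁ G : ℕ → ℚ
    δ₁ (suc zero) = 1ℚ
    δ₁ _          = 0ℚ
    G k = sumFrom1 k δ₁
    G-one : ∀ k → G (suc k) ≡ 1ℚ
    G-one zero    = refl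
    G-one (suc k) = trans (ℚ.+-identityʳ _) (G-one k)
    one-as-partialSum : ∀ k → 0 ℕ.< k → k ℕ.≤ suc N →
      altSign k * ι (suc N C k) * 1ℚ ≡ altSign k * ι (suc N C k) * G k
    one-as-partialSum (suc k) _ _ = cong (altSign (suc k) * ι (suc N C suc k) *_) (sym (G-one k))
    cancel : ∀ a b → a + (- a + b) ≡ b
    cancel = solve-∀ ℚ-ring
    annihilate : ∀ a b → a * b * 0ℚ ≡ 0ℚ
    annihilate = solve-∀ ℚ-ring
    δ₁-vanishes : ∀ k → 0 ℕ.< k → k ℕ.≤ N → altSign (suc k) * ι (N C k) * δ₁ (suc k) ≡ 0ℚ
    δ₁-vanishes (suc k) _ _ = annihilate (altSign (suc (suc k))) (ι (N C suc k))

  recip² recip³ recip⁴ : ℕ → ℚ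
  recip² k = recip k * recip k
  recip³ k = recip² k * recip k
  recip⁴ k = recip³ k * recip k

  H⁽²⁾ H⁽³⁾ H⁽⁴⁾ : ℕ → ℚ
  H⁽²⁾ N = sumFrom1 N recip²
  H⁽³⁾ N = sumFrom1 N recip³
  H⁽⁴⁾ N = sumFrom1 N recip⁴

  -- H⋆ᵣ N = Σ_{1 ≤ k₁ ≤ ⋯ ≤ kᵣ ≤ N} 1/(k₁⋯kᵣ), the multiple harmonic star sum of depth r.
  H⋆₂ H⋆₃ H⋆₄ : ℕ → ℚ
  H⋆₂ N = sumFrom1 N (λ m → H m * recip m)
  H⋆₃ N = sumFrom1 N (λ m → H⋆₂ m * recip m)
  H⋆₄ N = sumFrom1 N (λ m → H⋆₃ m * recip m)

  -- e₂ N = Σ_{1 ≤ i < j ≤ N} 1/(ij)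
  e₂ : ℕ → ℚ
  e₂ zero    = 0ℚ
  e₂ (suc N) = e₂ N + H N * recip (suc N)

  binomialSum-recip : ∀ N → binomialSum N recip ≡ H N
  binomialSum-recip N = trans (binomialSum-cong N (λ k → sym (ℚ.*-identityˡ (recip k))))
    (trans (binomialSum-*recip N (λ _ → 1ℚ)) (sum-cong N termwise))
    where
    termwise : ∀ k → 0 ℕ.< k → k ℕ.≤ N → binomialSum k (λ _ → 1ℚ) * recip k ≡ recip k
    termwise (suc k) _ _ = trans (cong (_* recip (suc k)) (binomialSum-one k)) (ℚ.*-identityˡ (recip (suc k)))

  binomialSum-recip² : ∀ N → binomialSum N recip² ≡ H⋆₂ N
  binomialSum-recip² N = trans (binomialSum-*recip N recip) (sum-cong N (λ k _ _ → cong (_* recip k) (binomialSum-recip k)))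

  binomialSum-recip³ : ∀ N → binomialSum N recip³ ≡ H⋆₃ N
  binomialSum-recip³ N = trans (binomialSum-*recip N recip²) (sum-cong N (λ k _ _ → cong (_* recip k) (binomialSum-recip² k)))

  binomialSum-recip⁴ : ∀ N → binomialSum N recip⁴ ≡ H⋆₄ N
  binomialSum-recip⁴ N = trans (binomialSum-*recip N recip³) (sum-cong N (λ k _ _ → cong (_* recip k) (binomialSum-recip³ k)))

  binomialSum-H⁽³⁾*recip : ∀ N → binomialSum N (λ k → H⁽³⁾ k * recip k) ≡ sumFrom1 N (λ m → H⋆₂ m * recip² m)
  binomialSum-H⁽³⁾*recip N = trans (binomialSum-*recip N H⁽³⁾) (sum-cong N termwise)
    where
    reassoc : ∀ a x → a * x * x ≡ a * (x * x)
    reassoc = solve-∀ ℚ-ring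
    termwise : ∀ k → 0 ℕ.< k → k ℕ.≤ N → binomialSum k H⁽³⁾ * recip k ≡ H⋆₂ k * recip² k
    termwise k _ _ = trans (cong (_* recip k) (trans (binomialSum-partialSum k recip²) (cong (_* recip k) (binomialSum-recip² k))))
      (reassoc (H⋆₂ k) (recip k))

  H⋆₂-powerSums : ∀ N → ι 2 * H⋆₂ N ≡ H N * H N + H⁽²⁾ N
  H⋆₂-powerSums zero    = refl
  H⋆₂-powerSums (suc N) = trans (ℚ.*-distribˡ-+ (ι 2) (H⋆₂ N) _)
    (trans (cong (_+ ι 2 * (H (suc N) * x)) (H⋆₂-powerSums N)) (step (H N) (H⁽²⁾ N) x))
    where
    x = recip (suc N)
    step : ∀ h h2 x → h * h + h2 + ι 2 * ((h + x) * x) ≡ (h + x) * (h + x) + (h2 + x * x)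
    step = solve-∀ ℚ-ring

  H⋆₃-powerSums : ∀ N → ι 6 * H⋆₃ N ≡ H N * H N * H N + ι 3 * H N * H⁽²⁾ N + ι 2 * H⁽³⁾ N
  H⋆₃-powerSums zero    = refl
  H⋆₃-powerSums (suc N) = trans (split (H⋆₃ N) (H⋆₂ (suc N)) x)
    (trans (cong₂ (λ a b → a + ι 3 * b * x) (H⋆₃-powerSums N) (H⋆₂-powerSums (suc N))) (step (H N) (H⁽²⁾ N) (H⁽³⁾ N) x))
    where
    x = recip (suc N)
    split : ∀ a b x → ι 6 * (a + b * x) ≡ ι 6 * a + ι 3 * (ι 2 * b) * x
    split = solve-∀ ℚ-ring
    step : ∀ h h2 h3 x → h * h * h + ι 3 * h * h2 + ι 2 * h3 + ι 3 * ((h + x) * (h + x) + (h2 + x * x)) * x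
                       ≡ (h + x) * (h + x) * (h + x) + ι 3 * (h + x) * (h2 + x * x) + ι 2 * (h3 + x * x * x)
    step = solve-∀ ℚ-ring

  H⋆₄-powerSums : ∀ N → ι 24 * H⋆₄ N ≡ H N * H N * H N * H N + ι 6 * H N * H N * H⁽²⁾ N + ι 3 * H⁽²⁾ N * H⁽²⁾ N
                                        + ι 8 * H N * H⁽³⁾ N + ι 6 * H⁽⁴⁾ N
  H⋆₄-powerSums zero    = refl
  H⋆₄-powerSums (suc N) = trans (split (H⋆₄ N) (H⋆₃ (suc N)) x)
    (trans (cong₂ (λ a b → a + ι 4 * b * x) (H⋆₄-powerSums N) (H⋆₃-powerSums (suc N)))
      (step (H N) (H⁽²⁾ N) (H⁽³⁾ N) (H⁽⁴⁾ N) x))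
    where
    x = recip (suc N)
    split : ∀ a b x → ι 24 * (a + b * x) ≡ ι 24 * a + ι 4 * (ι 6 * b) * x
    split = solve-∀ ℚ-ring
    step : ∀ h h2 h3 h4 x → h * h * h * h + ι 6 * h * h * h2 + ι 3 * h2 * h2 + ι 8 * h * h3 + ι 6 * h4
            + ι 4 * ((h + x) * (h + x) * (h + x) + ι 3 * (h + x) * (h2 + x * x) + ι 2 * (h3 + x * x * x)) * x
          ≡ (h + x) * (h + x) * (h + x) * (h + x) + ι 6 * (h + x) * (h + x) * (h2 + x * x) + ι 3 * (h2 + x * x) * (h2 + x * x)
            + ι 8 * (h + x) * (h3 + x * x * x) + ι 6 * (h4 + x * x * x * x)
    step = solve-∀ ℚ-ring

  sum-H⁽²⁾*recip²-powerSums : ∀ N → ι 2 * sumFrom1 N (λ m → H⁽²⁾ m * recip² m) ≡ H⁽²⁾ N * H⁽²⁾ N + H⁽⁴⁾ N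
  sum-H⁽²⁾*recip²-powerSums zero    = refl
  sum-H⁽²⁾*recip²-powerSums (suc N) = trans (ℚ.*-distribˡ-+ (ι 2) (sumFrom1 N (λ m → H⁽²⁾ m * recip² m)) (H⁽²⁾ (suc N) * recip² (suc N)))
    (trans (cong (_+ ι 2 * (H⁽²⁾ (suc N) * recip² (suc N))) (sum-H⁽²⁾*recip²-powerSums N)) (step (H⁽²⁾ N) (H⁽⁴⁾ N) (recip (suc N))))
    where
    step : ∀ h2 h4 x → h2 * h2 + h4 + ι 2 * ((h2 + x * x) * (x * x)) ≡ (h2 + x * x) * (h2 + x * x) + (h4 + x * x * x * x)
    step = solve-∀ ℚ-ring

  sum-H⁽³⁾*recip+sum-H*recip³ : ∀ N →
    sumFrom1 N (λ k → H⁽³⁾ k * recip k) + sumFrom1 N (λ k → H k * recip³ k) ≡ H N * H⁽³⁾ N + H⁽⁴⁾ N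
  sum-H⁽³⁾*recip+sum-H*recip³ zero    = refl
  sum-H⁽³⁾*recip+sum-H*recip³ (suc N) = trans (interchange (sumFrom1 N (λ k → H⁽³⁾ k * recip k)) (sumFrom1 N (λ k → H k * recip³ k))
      (H⁽³⁾ (suc N) * x) (H (suc N) * recip³ (suc N)))
    (trans (cong (_+ (H⁽³⁾ (suc N) * x + H (suc N) * recip³ (suc N))) (sum-H⁽³⁾*recip+sum-H*recip³ N))
      (step (H N) (H⁽³⁾ N) (H⁽⁴⁾ N) x))
    where
    x = recip (suc N)
    interchange : ∀ a b c d → (a + c) + (b + d) ≡ (a + b) + (c + d)
    interchange = solve-∀ ℚ-ring
    step : ∀ h h3 h4 x → h * h3 + h4 + ((h3 + x * x * x) * x + (h + x) * (x * x * x)) ≡ (h + x) * (h3 + x * x * x) + (h4 + x * x * x * x)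
    step = solve-∀ ℚ-ring

  H-cube : ∀ N → ι 3 * sumFrom1 N (λ k → H k * H k * inv k 1) - ι 3 * sumFrom1 N (λ k → H k * inv k 2) + H⁽³⁾ N
                 ≡ H N * H N * H N
  H-cube zero    = refl
  H-cube (suc N) = trans (cong (λ t → ι 3 * S₂ (suc N) - ι 3 * (S₁ N + H (suc N) * t) + H⁽³⁾ (suc N)) (inv-sq (suc N)))
    (trans (regroup (S₂ N) (S₁ N) (H⁽³⁾ N) (H N) x) (trans (cong (_+ increment (H N) x) (H-cube N)) (step (H N) x)))
    where
    x = recip (suc N)
    S₁ S₂ : ℕ → ℚ
    S₁ N = sumFrom1 N (λ k → H k * inv k 2)
    S₂ N = sumFrom1 N (λ k → H k * H k * inv k 1)
    increment : ℚ → ℚ → ℚ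
    increment h x = ι 3 * ((h + x) * (h + x) * x) - ι 3 * ((h + x) * (x * x)) + x * x * x
    regroup : ∀ a b c h x → ι 3 * (a + (h + x) * (h + x) * x) - ι 3 * (b + (h + x) * (x * x)) + (c + x * x * x)
                          ≡ (ι 3 * a - ι 3 * b + c) + (ι 3 * ((h + x) * (h + x) * x) - ι 3 * ((h + x) * (x * x)) + x * x * x)
    regroup = solve-∀ ℚ-ring
    step : ∀ h x → h * h * h + (ι 3 * ((h + x) * (h + x) * x) - ι 3 * ((h + x) * (x * x)) + x * x * x) ≡ (h + x) * (h + x) * (h + x)
    step = solve-∀ ℚ-ring

  e₂≡H⋆₂-H⁽²⁾ : ∀ N → e₂ N ≡ H⋆₂ N - H⁽²⁾ N
  e₂≡H⋆₂-H⁽²⁾ zero    = refl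
  e₂≡H⋆₂-H⁽²⁾ (suc N) = linear-combination₁ 1ℚ (step (e₂ N) (H⋆₂ N) (H⁽²⁾ N) (H N) (recip (suc N))) (e₂≡H⋆₂-H⁽²⁾ N)
    where
    step : ∀ e p2 h2 h x → (e + h * x) - ((p2 + (h + x) * x) - (h2 + x * x)) ≡ 1ℚ * (e - (p2 - h2))
    step = solve-∀ ℚ-ring

module Divisibility (p : ℕ) (p-prime : Prime p) where

  open Arithmetic
  open import Defs
  open import Data.Nat as ℕ using (ℕ; zero; suc; z<s)
  import Data.Nat.Properties as ℕ
  open import Data.Nat.Divisibility as ∣ using (_∣_; divides)
  open import Data.Nat.Primality using (Prime; euclidsLemma; prime⇒nonZero; prime⇒nonTrivial)
  import Data.Nat.Coprimality as Coprimality
  open import Data.Integer as ℤ using (ℤ; +_)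
  import Data.Integer.Properties as ℤ
  open import Data.Rational as ℚ using (ℚ; 0ℚ; 1ℚ; _+_; _*_; _-_; -_; ↥_; ↧ₙ_; toℚᵘ)
  import Data.Rational.Properties as ℚ
  import Data.Rational.Unnormalised as ℚᵘ
  import Data.Rational.Unnormalised.Properties as ℚᵘ
  open import Data.Product using (_,_)
  open import Data.Sum using (inj₁; inj₂)
  open import Function using (_∘_)
  open import Relation.Nullary using (¬_; contradiction)
  open import Relation.Binary.PropositionalEquality
  open import Tactic.RingSolver using (solve-∀)

  instance
    p≢0 : ℕ.NonZero p
    p≢0 = prime⇒nonZero p-prime

  -- q has p-adic valuation at least r.
  infix 4 p^_∣_
  record p^_∣_ (r : ℕ) (q : ℚ) : Set where
    constructor divisible
    field
      den     : ℕ
      num     : ℤ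
      p∤den   : ¬ p ∣ den
      cleared : q * ι den ≡ ι (p ℕ.^ r) * ιℤ num

  p≢1 : p ≢ 1
  p≢1 = ℕ.nonTrivial⇒≢1 {{prime⇒nonTrivial p-prime}}

  p∤1 : ¬ p ∣ 1
  p∤1 p∣1 = p≢1 (∣.∣1⇒≡1 p∣1)

  p∤-* : ∀ {a b} → ¬ p ∣ a → ¬ p ∣ b → ¬ p ∣ a ℕ.* b
  p∤-* {a} {b} p∤a p∤b p∣ab with euclidsLemma a b p-prime p∣ab
  ... | inj₁ p∣a = p∤a p∣a
  ... | inj₂ p∣b = p∤b p∣b

  p∤-<p : ∀ {k} → 0 ℕ.< k → k ℕ.< p → ¬ p ∣ k
  p∤-<p {suc k} _ k<p = ∣.>⇒∤ k<p

  ι-p^-+ : ∀ r s → ι (p ℕ.^ (r ℕ.+ s)) ≡ ι (p ℕ.^ r) * ι (p ℕ.^ s)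
  ι-p^-+ r s = trans (cong ι (ℕ.^-distribˡ-+-* p r s)) (ι-homo-* (p ℕ.^ r) (p ℕ.^ s))

  ∣-respʳ : ∀ {r a b} → a ≡ b → p^ r ∣ a → p^ r ∣ b
  ∣-respʳ refl a-divisible = a-divisible

  ι-integral : ∀ n → p^ 0 ∣ ι n
  ι-integral n = divisible 1 (+ n) p∤1 (trans (ℚ.*-identityʳ (ι n)) (sym (ℚ.*-identityˡ (ι n))))

  recip-integral : ∀ {k} → 0 ℕ.< k → k ℕ.< p → p^ 0 ∣ recip k
  recip-integral {k} 0<k k<p = divisible k (+ 1) (p∤-<p 0<k k<p) (recip-inverseˡ k 0<k)

  ∣-0 : ∀ r → p^ r ∣ 0ℚ
  ∣-0 r = divisible 1 (+ 0) p∤1 (trans (ℚ.*-zeroˡ (ι 1)) (sym (ℚ.*-zeroʳ (ι (p ℕ.^ r)))))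

  ∣-+ : ∀ {r a b} → p^ r ∣ a → p^ r ∣ b → p^ r ∣ a + b
  ∣-+ {r} {a} {b} (divisible d₁ m₁ p∤d₁ e₁) (divisible d₂ m₂ p∤d₂ e₂) =
    divisible (d₁ ℕ.* d₂) (m₁ ℤ.* + d₂ ℤ.+ m₂ ℤ.* + d₁) (p∤-* p∤d₁ p∤d₂) (begin
      (a + b) * ι (d₁ ℕ.* d₂)                     ≡⟨ cong ((a + b) *_) (ι-homo-* d₁ d₂) ⟩
      (a + b) * (ι d₁ * ι d₂)                     ≡⟨ distrib a b (ι d₁) (ι d₂) ⟩
      (a * ι d₁) * ι d₂ + (b * ι d₂) * ι d₁       ≡⟨ cong₂ (λ x y → x * ι d₂ + y * ι d₁) e₁ e₂ ⟩
      (P * ιℤ m₁) * ι d₂ + (P * ιℤ m₂) * ι d₁     ≡⟨ factor P (ιℤ m₁) (ιℤ m₂) (ι d₁) (ι d₂) ⟩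
      P * (ιℤ m₁ * ι d₂ + ιℤ m₂ * ι d₁)
        ≡⟨ cong (P *_) (sym (trans (ιℤ-homo-+ (m₁ ℤ.* + d₂) (m₂ ℤ.* + d₁)) (cong₂ _+_ (ιℤ-homo-* m₁ (+ d₂)) (ιℤ-homo-* m₂ (+ d₁))))) ⟩
      P * ιℤ (m₁ ℤ.* + d₂ ℤ.+ m₂ ℤ.* + d₁)        ∎)
    where
    open ≡-Reasoning
    P = ι (p ℕ.^ r)
    distrib : ∀ a b x y → (a + b) * (x * y) ≡ (a * x) * y + (b * y) * x
    distrib = solve-∀ ℚ-ring
    factor : ∀ P m₁ m₂ x y → (P * m₁) * y + (P * m₂) * x ≡ P * (m₁ * y + m₂ * x)
    factor = solve-∀ ℚ-ring

  ∣-neg : ∀ {r a} → p^ r ∣ a → p^ r ∣ - a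
  ∣-neg {r} {a} (divisible d m p∤d e) = divisible d (ℤ.- m) p∤d
    (trans (sym (ℚ.neg-distribˡ-* a (ι d))) (trans (cong -_ e)
      (trans (ℚ.neg-distribʳ-* (ι (p ℕ.^ r)) (ιℤ m)) (cong (ι (p ℕ.^ r) *_) (sym (ιℤ-homo-neg m))))))

  ∣-- : ∀ {r a b} → p^ r ∣ a → p^ r ∣ b → p^ r ∣ a - b
  ∣-- a-divisible b-divisible = ∣-+ a-divisible (∣-neg b-divisible)

  ∣-* : ∀ {r s a b} → p^ r ∣ a → p^ s ∣ b → p^ (r ℕ.+ s) ∣ a * b
  ∣-* {r} {s} {a} {b} (divisible d₁ m₁ p∤d₁ e₁) (divisible d₂ m₂ p∤d₂ e₂) =
    divisible (d₁ ℕ.* d₂) (m₁ ℤ.* m₂) (p∤-* p∤d₁ p∤d₂) (begin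
      (a * b) * ι (d₁ ℕ.* d₂)                           ≡⟨ cong ((a * b) *_) (ι-homo-* d₁ d₂) ⟩
      (a * b) * (ι d₁ * ι d₂)                           ≡⟨ interchange a b (ι d₁) (ι d₂) ⟩
      (a * ι d₁) * (b * ι d₂)                           ≡⟨ cong₂ _*_ e₁ e₂ ⟩
      (ι (p ℕ.^ r) * ιℤ m₁) * (ι (p ℕ.^ s) * ιℤ m₂)     ≡⟨ interchange (ι (p ℕ.^ r)) (ιℤ m₁) (ι (p ℕ.^ s)) (ιℤ m₂) ⟩
      (ι (p ℕ.^ r) * ι (p ℕ.^ s)) * (ιℤ m₁ * ιℤ m₂)     ≡⟨ cong₂ _*_ (sym (ι-p^-+ r s)) (sym (ιℤ-homo-* m₁ m₂)) ⟩
      ι (p ℕ.^ (r ℕ.+ s)) * ιℤ (m₁ ℤ.* m₂)              ∎)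
    where
    open ≡-Reasoning
    interchange : ∀ a b x y → (a * b) * (x * y) ≡ (a * x) * (b * y)
    interchange = solve-∀ ℚ-ring

  ∣-*-integral : ∀ {r a b} → p^ r ∣ a → p^ 0 ∣ b → p^ r ∣ a * b
  ∣-*-integral {r} a-divisible b-integral = subst (p^_∣ _) (ℕ.+-identityʳ r) (∣-* a-divisible b-integral)

  p*-∣ : ∀ {r a} → p^ r ∣ a → p^ suc r ∣ ι p * a
  p*-∣ {r} {a} (divisible d m p∤d e) = divisible d m p∤d (begin
    ι p * a * ι d              ≡⟨ ℚ.*-assoc (ι p) a (ι d) ⟩
    ι p * (a * ι d)            ≡⟨ cong (ι p *_) e ⟩
    ι p * (ι (p ℕ.^ r) * ιℤ m) ≡⟨ ℚ.*-assoc (ι p) (ι (p ℕ.^ r)) (ιℤ m) ⟨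
    ι p * ι (p ℕ.^ r) * ιℤ m   ≡⟨ cong (_* ιℤ m) (ι-homo-* p (p ℕ.^ r)) ⟨
    ι (p ℕ.^ suc r) * ιℤ m     ∎)
    where open ≡-Reasoning

  ∣-*recip-p : ∀ {r a} → p^ suc r ∣ a → p^ r ∣ a * recip p
  ∣-*recip-p {r} {a} (divisible d m p∤d e) = divisible d m p∤d (begin
    a * y * ι d                        ≡⟨ rearrange a y (ι d) ⟩
    y * (a * ι d)                      ≡⟨ cong (y *_) (trans e (cong (_* ιℤ m) (ι-homo-* p (p ℕ.^ r)))) ⟩
    y * (ι p * ι (p ℕ.^ r) * ιℤ m)     ≡⟨ regroup y (ι p) (ι (p ℕ.^ r)) (ιℤ m) ⟩
    (y * ι p) * (ι (p ℕ.^ r) * ιℤ m)   ≡⟨ cong (_* (ι (p ℕ.^ r) * ιℤ m)) (recip-inverseˡ p (ℕ.>-nonZero⁻¹ p)) ⟩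
    1ℚ * (ι (p ℕ.^ r) * ιℤ m)          ≡⟨ ℚ.*-identityˡ _ ⟩
    ι (p ℕ.^ r) * ιℤ m                 ∎)
    where
    open ≡-Reasoning
    y = recip p
    rearrange : ∀ a b c → a * b * c ≡ b * (a * c)
    rearrange = solve-∀ ℚ-ring
    regroup : ∀ a b c d → a * (b * c * d) ≡ (a * b) * (c * d)
    regroup = solve-∀ ℚ-ring

  ∣-weaken : ∀ {r a} → p^ suc r ∣ a → p^ r ∣ a
  ∣-weaken {r} {a} (divisible d m p∤d e) = divisible d (+ p ℤ.* m) p∤d (trans e (begin
    ι (p ℕ.^ suc r) * ιℤ m       ≡⟨ cong (_* ιℤ m) (trans (ι-homo-* p (p ℕ.^ r)) (ℚ.*-comm (ι p) (ι (p ℕ.^ r)))) ⟩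
    ι (p ℕ.^ r) * ι p * ιℤ m     ≡⟨ ℚ.*-assoc (ι (p ℕ.^ r)) (ι p) (ιℤ m) ⟩
    ι (p ℕ.^ r) * (ι p * ιℤ m)   ≡⟨ cong (ι (p ℕ.^ r) *_) (sym (ιℤ-homo-* (+ p) m)) ⟩
    ι (p ℕ.^ r) * ιℤ (+ p ℤ.* m) ∎))
    where open ≡-Reasoning

  ∣-≤ : ∀ {r s a} → r ℕ.≤ s → p^ s ∣ a → p^ r ∣ a
  ∣-≤ {r} {s} {a} r≤s = weaken-by (s ℕ.∸ r) ∘ subst (p^_∣ a) (sym (ℕ.m∸n+n≡m r≤s))
    where
    weaken-by : ∀ t {r} → p^ t ℕ.+ r ∣ a → p^ r ∣ a
    weaken-by zero    a-divisible = a-divisible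
    weaken-by (suc t) a-divisible = weaken-by t (∣-weaken a-divisible)

  ∣-cancelˡ : ∀ {r a} c → 0 ℕ.< c → c ℕ.< p → p^ r ∣ ι c * a → p^ r ∣ a
  ∣-cancelˡ {r} {a} c 0<c c<p ca-divisible =
    ∣-respʳ cancel (∣-* (recip-integral 0<c c<p) ca-divisible)
    where
    regroup : ∀ a b c → a * (b * c) ≡ (a * b) * c
    regroup = solve-∀ ℚ-ring
    cancel : recip c * (ι c * a) ≡ a
    cancel = trans (regroup (recip c) (ι c) a) (trans (cong (_* a) (recip-inverseˡ c 0<c)) (ℚ.*-identityˡ a))

  ∣-sum : ∀ {r} N f → (∀ k → 0 ℕ.< k → k ℕ.≤ N → p^ r ∣ f k) → p^ r ∣ sumFrom1 N f
  ∣-sum {r} zero    f _           = ∣-0 r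
  ∣-sum     (suc N) f f-divisible =
    ∣-+ (∣-sum N f (λ k 0<k k≤N → f-divisible k 0<k (ℕ.m≤n⇒m≤1+n k≤N))) (f-divisible (suc N) z<s ℕ.≤-refl)

  cross-multiplied : ∀ q d z → q * ι d ≡ ιℤ z → ℤ.∣ ↥ q ∣ ℕ.* d ≡ ℤ.∣ z ∣ ℕ.* ↧ₙ q
  cross-multiplied q@(ℚ.mkℚ n d-1 _) d z e = begin
    ℤ.∣ n ∣ ℕ.* d                   ≡⟨ ℤ.abs-* n (+ d) ⟨
    ℤ.∣ n ℤ.* + d ∣                 ≡⟨ cong ℤ.∣_∣ (ℤ.*-identityʳ (n ℤ.* + d)) ⟨
    ℤ.∣ (n ℤ.* + d) ℤ.* + 1 ∣       ≡⟨ cong ℤ.∣_∣ (ℚᵘ.drop-*≡* unnormalised) ⟩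
    ℤ.∣ z ℤ.* + (suc d-1 ℕ.* 1) ∣   ≡⟨ ℤ.abs-* z _ ⟩
    ℤ.∣ z ∣ ℕ.* (suc d-1 ℕ.* 1)     ≡⟨ cong (ℤ.∣ z ∣ ℕ.*_) (ℕ.*-identityʳ (suc d-1)) ⟩
    ℤ.∣ z ∣ ℕ.* suc d-1             ∎
    where
    open ≡-Reasoning
    unnormalised : toℚᵘ q ℚᵘ.* ℚᵘ.mkℚᵘ (+ d) 0 ℚᵘ.≃ ℚᵘ.mkℚᵘ z 0
    unnormalised = ℚᵘ.≃-trans
      (ℚᵘ.≃-sym (ℚᵘ.≃-trans (ℚ.toℚᵘ-homo-* q (ι d)) (ℚᵘ.*-cong (ℚᵘ.≃-refl {toℚᵘ q}) (ℚ.toℚᵘ-fromℚᵘ (ℚᵘ.mkℚᵘ (+ d) 0)))))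
      (ℚᵘ.≃-trans (ℚ.toℚᵘ-cong e) (ℚ.toℚᵘ-fromℚᵘ (ℚᵘ.mkℚᵘ z 0)))

  p^r∣m*n∧p∤n⇒p^r∣m : ∀ r m {n} → ¬ p ∣ n → p ℕ.^ r ∣ m ℕ.* n → p ℕ.^ r ∣ m
  p^r∣m*n∧p∤n⇒p^r∣m zero    m p∤n _ = ∣.1∣ m
  p^r∣m*n∧p∤n⇒p^r∣m (suc r) m {n} p∤n p^[1+r]∣mn with euclidsLemma m n p-prime (∣.∣-trans (∣.m∣m*n (p ℕ.^ r)) p^[1+r]∣mn)
  ... | inj₂ p∣n = contradiction p∣n p∤n
  ... | inj₁ (divides m′ refl) = subst (p ℕ.* p ℕ.^ r ∣_) (ℕ.*-comm p m′) (∣.*-monoʳ-∣ p p^r∣m′)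
    where
    p^r∣m′ : p ℕ.^ r ∣ m′
    p^r∣m′ = p^r∣m*n∧p∤n⇒p^r∣m r m′ p∤n (∣.*-cancelˡ-∣ p
      (subst (p ℕ.* p ℕ.^ r ∣_) (trans (cong (ℕ._* n) (ℕ.*-comm m′ p)) (ℕ.*-assoc p m′ n)) p^[1+r]∣mn))

  integral⇒p∤denominator : ∀ {q} → p^ 0 ∣ q → ¬ p ∣ ↧ₙ q
  integral⇒p∤denominator {q@(ℚ.mkℚ _ _ coprime)} (divisible d m p∤d e) p∣den
    with euclidsLemma (ℤ.∣ ↥ q ∣) d p-prime
           (subst (p ∣_) (sym (cross-multiplied q d m (trans e (ℚ.*-identityˡ (ιℤ m))))) (∣.∣n⇒∣m*n ℤ.∣ m ∣ p∣den))
  ... | inj₂ p∣d   = p∤d p∣d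
  ... | inj₁ p∣num = p≢1 (Coprimality.recompute coprime (p∣num , p∣den))

  ∣⇒p^r∣numerator : ∀ {r q} → p^ r ∣ q → p ℕ.^ r ∣ ℤ.∣ ↥ q ∣
  ∣⇒p^r∣numerator {r} {q} (divisible d m p∤d e) = p^r∣m*n∧p∤n⇒p^r∣m r (ℤ.∣ ↥ q ∣) p∤d
    (subst (p ℕ.^ r ∣_) (sym (cross-multiplied q d (+ (p ℕ.^ r) ℤ.* m) (trans e (sym (ιℤ-homo-* (+ (p ℕ.^ r)) m)))))
      (subst (p ℕ.^ r ∣_) (sym (cong (ℕ._* ↧ₙ q) (ℤ.abs-* (+ (p ℕ.^ r)) m)))
        (∣.∣m⇒∣m*n (↧ₙ q) (∣.m∣m*n ℤ.∣ m ∣))))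

  ∣⇒≡[mod] : ∀ {r a b} → p^ 0 ∣ a → p^ 0 ∣ b → p^ r ∣ a - b → a ≡ b [mod p ^ r ]
  ∣⇒≡[mod] a-integral b-integral a-b-divisible =
    integral⇒p∤denominator a-integral , integral⇒p∤denominator b-integral , ∣⇒p^r∣numerator a-b-divisible

module PowerSums (n : ℕ) (p-prime : Prime (suc n)) (7≤p : 7 ≤ suc n) where

  open Arithmetic
  open BinomialSums
  open import Defs
  open import Data.Nat as ℕ using (ℕ; zero; suc; z≤n; s≤s; z<s)
  import Data.Nat.Properties as ℕ
  open import Data.Nat.Primality using (Prime)
  open import Data.Nat.Combinatorics using (_C_; nCk+nC[k+1]≡[n+1]C[k+1])
  open import Data.Rational as ℚ using (ℚ; 0ℚ; 1ℚ; _+_; _*_; _-_; -_)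
  import Data.Rational.Properties as ℚ
  open import Relation.Nullary.Decidable using (True; toWitness)
  open import Relation.Binary.PropositionalEquality
  open import Tactic.RingSolver using (solve-∀)

  p : ℕ
  p = suc n

  open Divisibility p p-prime public

  <p : ∀ c → {True (c ℕ.<? 7)} → c ℕ.< p
  <p c {c<7} = ℕ.<-≤-trans (toWitness c<7) 7≤p

  Integral<p : (ℕ → ℚ) → Set
  Integral<p f = ∀ k → 0 ℕ.< k → k ℕ.≤ n → p^ 0 ∣ f k

  recip-integral<p : Integral<p recip
  recip-integral<p k 0<k k≤n = recip-integral 0<k (s≤s k≤n)

  *-integral<p : ∀ {f g} → Integral<p f → Integral<p g → Integral<p (λ k → f k * g k)
  *-integral<p f-integral g-integral k 0<k k≤n = ∣-* (f-integral k 0<k k≤n) (g-integral k 0<k k≤n)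

  recip²-integral<p : Integral<p recip²
  recip²-integral<p = *-integral<p recip-integral<p recip-integral<p

  recip³-integral<p : Integral<p recip³
  recip³-integral<p = *-integral<p recip²-integral<p recip-integral<p

  recip⁴-integral<p : Integral<p recip⁴
  recip⁴-integral<p = *-integral<p recip³-integral<p recip-integral<p

  partialSum-integral : ∀ {f} → Integral<p f → ∀ N → N ℕ.≤ n → p^ 0 ∣ sumFrom1 N f
  partialSum-integral f-integral N N≤n = ∣-sum N _ (λ k 0<k k≤N → f-integral k 0<k (ℕ.≤-trans k≤N N≤n))

  H-integral : ∀ N → N ℕ.≤ n → p^ 0 ∣ H N
  H-integral = partialSum-integral recip-integral<p

  H⁽²⁾-integral : ∀ N → N ℕ.≤ n → p^ 0 ∣ H⁽²⁾ N
  H⁽²⁾-integral = partialSum-integral recip²-integral<p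

  H⁽³⁾-integral : ∀ N → N ℕ.≤ n → p^ 0 ∣ H⁽³⁾ N
  H⁽³⁾-integral = partialSum-integral recip³-integral<p

  e₂-integral : ∀ N → N ℕ.≤ n → p^ 0 ∣ e₂ N
  e₂-integral zero    _   = ∣-0 0
  e₂-integral (suc N) N<n = ∣-+ (e₂-integral N (ℕ.≤-trans (ℕ.n≤1+n N) N<n))
    (∣-* (H-integral N (ℕ.≤-trans (ℕ.n≤1+n N) N<n)) (recip-integral<p (suc N) z<s N<n))

  signedBinom : ℕ → ℚ
  signedBinom k = - altSign k * ι (n C k)

  signedBinom-suc : ∀ k → signedBinom (suc k) ≡ signedBinom k * (1ℚ - ι p * recip (suc k))
  signedBinom-suc k = linear-combination₂ (- (altSign k * (A + B))) (altSign k * x)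
    (ring-identity (altSign k) A B K x (ι p)) (recip-inverseˡ (suc k) z<s) absorption
    where
    A = ι (n C suc k)
    B = ι (n C k)
    K = ι (suc k)
    x = recip (suc k)
    ring-identity : ∀ s A B K x P → (- (- s)) * A - (- s * B) * (1ℚ - P * x)
                                  ≡ - (s * (A + B)) * (x * K - 1ℚ) + (s * x) * (K * A + K * B - P * B)
    ring-identity = solve-∀ ℚ-ring
    absorption : K * A + K * B ≡ ι p * B
    absorption = begin
      K * A + K * B                    ≡⟨ ℚ.*-distribˡ-+ K A B ⟨
      K * (A + B)                      ≡⟨ cong (K *_) (ι-homo-+ (n C suc k) (n C k)) ⟨
      K * ι (n C suc k ℕ.+ n C k)      ≡⟨ cong (λ m → K * ι m) (trans (ℕ.+-comm (n C suc k) (n C k)) (nCk+nC[k+1]≡[n+1]C[k+1] n k)) ⟩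
      K * ι (p C suc k)                ≡⟨ ι-homo-* (suc k) (p C suc k) ⟨
      ι (suc k ℕ.* (p C suc k))        ≡⟨ cong ι ([k+1]*[n+1]C[k+1]≡[n+1]*nCk n k) ⟩
      ι (p ℕ.* (n C k))                ≡⟨ ι-homo-* p (n C k) ⟩
      ι p * B                          ∎
      where open ≡-Reasoning

  binomialSum≡-signedSum : ∀ f → binomialSum n f ≡ - sumFrom1 n (λ k → signedBinom k * f k)
  binomialSum≡-signedSum f = trans (sum-cong n (λ k _ _ → double-negation (altSign k) (ι (n C k)) (f k)))
    (sum-distrib-neg n (λ k → signedBinom k * f k))
    where
    double-negation : ∀ s c f → s * c * f ≡ - ((- s) * c * f)
    double-negation = solve-∀ ℚ-ring

  -- The first terms of the expansion signedBinom k = Π_{j ≤ k} (1 - p/j) = 1 - p H_k + p² e₂ k - ⋯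
  signedBinom-remainder : ℕ → ℚ
  signedBinom-remainder k = signedBinom k - 1ℚ + ι p * H k - ι p * ι p * e₂ k

  signedBinom-remainder-suc : ∀ k → signedBinom-remainder (suc k)
    ≡ (1ℚ - ι p * recip (suc k)) * signedBinom-remainder k - ι p * (ι p * (ι p * (e₂ k * recip (suc k))))
  signedBinom-remainder-suc k = linear-combination₁ 1ℚ
    (ring-identity (signedBinom (suc k)) (signedBinom k) (H k) (e₂ k) (recip (suc k)) (ι p)) (signedBinom-suc k)
    where
    ring-identity : ∀ c′ c h e x P →
      (c′ - 1ℚ + P * (h + x) - P * P * (e + h * x)) - ((1ℚ - P * x) * (c - 1ℚ + P * h - P * P * e) - P * (P * (P * (e * x))))
      ≡ 1ℚ * (c′ - c * (1ℚ - P * x))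
    ring-identity = solve-∀ ℚ-ring

  p³∣signedBinom-remainder : ∀ k → k ℕ.≤ n → p^ 3 ∣ signedBinom-remainder k
  p³∣signedBinom-remainder zero    _   = ∣-respʳ (vanishes (ι p)) (∣-0 3)
    where
    vanishes : ∀ P → 0ℚ ≡ 1ℚ - 1ℚ + P * 0ℚ - P * P * 0ℚ
    vanishes = solve-∀ ℚ-ring
  p³∣signedBinom-remainder (suc k) k<n = ∣-respʳ (sym (signedBinom-remainder-suc k))
    (∣-- (∣-* (∣-- (ι-integral 1) (∣-* (ι-integral p) (recip-integral<p (suc k) z<s k<n))) (p³∣signedBinom-remainder k k≤n))
         (p*-∣ (p*-∣ (p*-∣ (∣-* (e₂-integral k k≤n) (recip-integral<p (suc k) z<s k<n))))))
    where
    k≤n = ℕ.≤-trans (ℕ.n≤1+n k) k<n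

  p∣signedBinom-1 : ∀ k → k ℕ.≤ n → p^ 1 ∣ signedBinom k - 1ℚ
  p∣signedBinom-1 k k≤n = ∣-respʳ (sym (regroup (signedBinom k) (H k) (e₂ k) (ι p)))
    (∣-+ (∣-- (∣-≤ z<s (p³∣signedBinom-remainder k k≤n)) (p*-∣ (H-integral k k≤n)))
         (p*-∣ (∣-≤ z≤n (p*-∣ (e₂-integral k k≤n)))))
    where
    regroup : ∀ c h e P → c - 1ℚ ≡ (c - 1ℚ + P * h - P * P * e) - P * h + P * (P * e)
    regroup = solve-∀ ℚ-ring

  p∣binomialSum+sum : ∀ f → Integral<p f → p^ 1 ∣ binomialSum n f + sumFrom1 n f
  p∣binomialSum+sum f f-integral = ∣-respʳ (trans (sum-cong n (λ k _ _ → rearrange (altSign k) (ι (n C k)) (f k))) (sum-distrib-+ n _ f))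
    (∣-sum n _ (λ k 0<k k≤n → ∣-neg (∣-* (p∣signedBinom-1 k k≤n) (f-integral k 0<k k≤n))))
    where
    rearrange : ∀ s c f → - (((- s) * c - 1ℚ) * f) ≡ s * c * f + f
    rearrange = solve-∀ ℚ-ring

  p∣H : p^ 1 ∣ H n
  p∣H = ∣-cancelˡ 2 z<s (<p 2) (∣-respʳ (trans (cong (_+ H n) (binomialSum-recip n)) (double (H n)))
    (p∣binomialSum+sum recip recip-integral<p))
    where
    double : ∀ a → a + a ≡ ι 2 * a
    double = solve-∀ ℚ-ring

  p∣H⁽²⁾ : p^ 1 ∣ H⁽²⁾ n
  p∣H⁽²⁾ = ∣-cancelˡ 3 z<s (<p 3) (∣-respʳ three-H⁽²⁾
    (∣-- (∣-* (ι-integral 2) (p∣binomialSum+sum recip² recip²-integral<p)) (∣-* p∣H (H-integral n ℕ.≤-refl))))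
    where
    ring-identity : ∀ t s a₁ a₂ → ι 2 * (t + a₂) - a₁ * a₁ - ι 3 * a₂ ≡ ι 2 * (t - s) + 1ℚ * (ι 2 * s - (a₁ * a₁ + a₂))
    ring-identity = solve-∀ ℚ-ring
    three-H⁽²⁾ : ι 2 * (binomialSum n recip² + H⁽²⁾ n) - H n * H n ≡ ι 3 * H⁽²⁾ n
    three-H⁽²⁾ = linear-combination₂ (ι 2) 1ℚ (ring-identity (binomialSum n recip²) (H⋆₂ n) (H n) (H⁽²⁾ n))
      (binomialSum-recip² n) (H⋆₂-powerSums n)

  p∣H⁽⁴⁾ : p^ 1 ∣ H⁽⁴⁾ n
  p∣H⁽⁴⁾ = ∣-cancelˡ 2 z<s (<p 2) (∣-cancelˡ 3 z<s (<p 3) (∣-cancelˡ 5 z<s (<p 5) (∣-respʳ thirty-H⁽⁴⁾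
    (∣-- (∣-* (ι-integral 24) (p∣binomialSum+sum recip⁴ recip⁴-integral<p))
      (∣-+ (∣-+ (∣-+ (∣-* (∣-* (∣-* p∣H h) h) h) (∣-* (∣-* (∣-* (ι-integral 6) p∣H) h) h₂)) (∣-* (∣-* (ι-integral 3) p∣H⁽²⁾) h₂))
           (∣-* (∣-* (ι-integral 8) p∣H) (H⁽³⁾-integral n ℕ.≤-refl)))))))
    where
    h = H-integral n ℕ.≤-refl
    h₂ = H⁽²⁾-integral n ℕ.≤-refl
    ring-identity : ∀ t s a₁ a₂ a₃ a₄ →
      ι 24 * (t + a₄) - (a₁ * a₁ * a₁ * a₁ + ι 6 * a₁ * a₁ * a₂ + ι 3 * a₂ * a₂ + ι 8 * a₁ * a₃) - ι 5 * (ι 3 * (ι 2 * a₄))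
      ≡ ι 24 * (t - s) + 1ℚ * (ι 24 * s - (a₁ * a₁ * a₁ * a₁ + ι 6 * a₁ * a₁ * a₂ + ι 3 * a₂ * a₂ + ι 8 * a₁ * a₃ + ι 6 * a₄))
    ring-identity = solve-∀ ℚ-ring
    thirty-H⁽⁴⁾ : ι 24 * (binomialSum n recip⁴ + H⁽⁴⁾ n)
                  - (H n * H n * H n * H n + ι 6 * H n * H n * H⁽²⁾ n + ι 3 * H⁽²⁾ n * H⁽²⁾ n + ι 8 * H n * H⁽³⁾ n)
                  ≡ ι 5 * (ι 3 * (ι 2 * H⁽⁴⁾ n))
    thirty-H⁽⁴⁾ = linear-combination₂ (ι 24) 1ℚ (ring-identity (binomialSum n recip⁴) (H⋆₄ n) (H n) (H⁽²⁾ n) (H⁽³⁾ n) (H⁽⁴⁾ n))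
      (binomialSum-recip⁴ n) (H⋆₄-powerSums n)

  recip[p∸k]-integral<p : Integral<p (λ k → recip (p ℕ.∸ k))
  recip[p∸k]-integral<p (suc k) _ k<n = recip-integral<p (p ℕ.∸ suc k) (ℕ.m<n⇒0<n∸m (s≤s k<n)) (ℕ.m∸n≤m n k)

  recip+recip[p∸k] : ∀ k → 0 ℕ.< k → k ℕ.≤ n → recip k + recip (p ℕ.∸ k) ≡ ι p * (recip k * recip (p ℕ.∸ k))
  recip+recip[p∸k] k 0<k k≤n = linear-combination₃ (- x) (- y) (x * y) (ring-identity x y (ι k) (ι (p ℕ.∸ k)) (ι p))
    (recip-inverseˡ (p ℕ.∸ k) (ℕ.m<n⇒0<n∸m (s≤s k≤n))) (recip-inverseˡ k 0<k)
    (trans (sym (ι-homo-+ k (p ℕ.∸ k))) (cong ι (ℕ.m+[n∸m]≡n (ℕ.m≤n⇒m≤1+n k≤n))))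
    where
    x = recip k
    y = recip (p ℕ.∸ k)
    ring-identity : ∀ x y K K′ P → x + y - P * (x * y) ≡ (- x) * (y * K′ - 1ℚ) + (- y) * (x * K - 1ℚ) + (x * y) * (K + K′ - P)
    ring-identity = solve-∀ ℚ-ring

  p∣recip+recip[p∸k] : ∀ k → 0 ℕ.< k → k ℕ.≤ n → p^ 1 ∣ recip k + recip (p ℕ.∸ k)
  p∣recip+recip[p∸k] k 0<k k≤n = ∣-respʳ (sym (recip+recip[p∸k] k 0<k k≤n))
    (p*-∣ (∣-* (recip-integral<p k 0<k k≤n) (recip[p∸k]-integral<p k 0<k k≤n)))

  p∣H[n∸j]-H[j] : ∀ j → j ℕ.≤ n → p^ 1 ∣ H (n ℕ.∸ j) - H j
  p∣H[n∸j]-H[j] zero    _   = ∣-- p∣H (∣-0 1)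
  p∣H[n∸j]-H[j] (suc j) j<n = ∣-respʳ (sym step) (∣-- (p∣H[n∸j]-H[j] j (ℕ.≤-trans (ℕ.n≤1+n j) j<n)) (p∣recip+recip[p∸k] (suc j) z<s j<n))
    where
    m = n ℕ.∸ suc j
    suc-m : suc m ≡ n ℕ.∸ j
    suc-m = sym (ℕ.+-∸-assoc 1 j<n)
    H-suc-m : H (n ℕ.∸ j) ≡ H m + recip (n ℕ.∸ j)
    H-suc-m = trans (cong H (sym suc-m)) (cong (λ t → H m + recip t) suc-m)
    ring-identity : ∀ hm hj x y hnj → hm - (hj + x) - ((hnj - hj) - (x + y)) ≡ (- 1ℚ) * (hnj - (hm + y))
    ring-identity = solve-∀ ℚ-ring
    step : H m - H (suc j) ≡ (H (n ℕ.∸ j) - H j) - (recip (suc j) + recip (p ℕ.∸ suc j))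
    step = linear-combination₁ (- 1ℚ) (ring-identity (H m) (H j) (recip (suc j)) (recip (p ℕ.∸ suc j)) (H (n ℕ.∸ j))) H-suc-m

  -- Pairing k with p - k, and using H_{p-1-k} ≡ H_k, the sum equals twice itself minus H⁽⁴⁾ modulo p.
  p∣sum-H*recip³ : p^ 1 ∣ sumFrom1 n (λ k → H k * recip³ k)
  p∣sum-H*recip³ = ∣-cancelˡ 2 z<s (<p 2) (∣-respʳ doubled (∣-+ (∣-respʳ paired (∣-sum n _ pair-divisible)) p∣H⁽⁴⁾))
    where
    Z = sumFrom1 n (λ k → H k * recip³ k)
    f g : ℕ → ℚ
    f k = H (p ℕ.∸ k) * recip³ (p ℕ.∸ k)
    g k = H (ℕ.pred k) * recip³ k
    sum-of-cubes : ∀ a b w x → a * (w * w * w) + b * (x * x * x) ≡ (a - b) * (w * w * w) + b * ((w + x) * (w * w - w * x + x * x))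
    sum-of-cubes = solve-∀ ℚ-ring
    pair-divisible : ∀ k → 0 ℕ.< k → k ℕ.≤ n → p^ 1 ∣ f k + g k
    pair-divisible (suc k) 0<k k<n = ∣-respʳ (sym (sum-of-cubes (H (n ℕ.∸ k)) (H k) w x))
      (∣-+ (∣-* (p∣H[n∸j]-H[j] k k≤n) (recip³-integral<p (p ℕ.∸ suc k) (ℕ.m<n⇒0<n∸m (s≤s k<n)) (ℕ.m∸n≤m n k)))
           (∣-* (H-integral k k≤n) (∣-* (∣-respʳ (ℚ.+-comm x w) (p∣recip+recip[p∸k] (suc k) 0<k k<n))
             (∣-+ (∣-- (∣-* w-integral w-integral) (∣-* w-integral x-integral)) (∣-* x-integral x-integral)))))
      where
      k≤n = ℕ.≤-trans (ℕ.n≤1+n k) k<n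
      x = recip (suc k)
      w = recip (p ℕ.∸ suc k)
      x-integral = recip-integral<p (suc k) 0<k k<n
      w-integral = recip[p∸k]-integral<p (suc k) 0<k k<n
    shift : ∀ b x → b * (x * x * x) ≡ (b + x) * (x * x * x) - x * x * x * x
    shift = solve-∀ ℚ-ring
    paired : sumFrom1 n (λ k → f k + g k) ≡ Z + (Z - H⁽⁴⁾ n)
    paired = trans (sum-distrib-+ n f g) (cong₂ _+_ (sym (sum-reverse n (λ k → H k * recip³ k)))
      (trans (sum-cong n (λ { (suc k) _ _ → shift (H k) (recip (suc k)) })) (sum-distrib-- n _ _)))
    collect : ∀ z a → z + (z - a) + a ≡ ι 2 * z
    collect = solve-∀ ℚ-ring
    doubled : Z + (Z - H⁽⁴⁾ n) + H⁽⁴⁾ n ≡ ι 2 * Z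
    doubled = collect Z (H⁽⁴⁾ n)

  p²∣H⁽³⁾ : p^ 2 ∣ H⁽³⁾ n
  p²∣H⁽³⁾ = ∣-cancelˡ 2 z<s (<p 2) (∣-respʳ (collect (H⁽³⁾ n) (H⁽⁴⁾ n) (ι p))
    (∣-- (∣-respʳ paired (∣-sum n _ pair-divisible)) (∣-* (ι-integral 3) (p*-∣ p∣H⁽⁴⁾))))
    where
    g : ℕ → ℚ
    g k = recip³ k + recip³ (p ℕ.∸ k) + ι 3 * ι p * recip⁴ k
    ring-identity : ∀ x y P → (x * x * x + y * y * y + ι 3 * P * (x * x * x * x)) - P * ((x + y) * (x * (y * y) - ι 2 * (x * x) * y + ι 3 * (x * x * x)))
                            ≡ (x * x - x * y + y * y) * ((x + y) - P * (x * y))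
    ring-identity = solve-∀ ℚ-ring
    pair-divisible : ∀ k → 0 ℕ.< k → k ℕ.≤ n → p^ 2 ∣ g k
    pair-divisible k 0<k k≤n = ∣-respʳ (sym (linear-combination₁ (x * x - x * y + y * y) (ring-identity x y (ι p)) (recip+recip[p∸k] k 0<k k≤n)))
      (p*-∣ (∣-* (p∣recip+recip[p∸k] k 0<k k≤n)
        (∣-+ (∣-- (∣-* x-integral (∣-* y-integral y-integral)) (∣-* (∣-* (ι-integral 2) (∣-* x-integral x-integral)) y-integral))
             (∣-* (ι-integral 3) (recip³-integral<p k 0<k k≤n)))))
      where
      x = recip k
      y = recip (p ℕ.∸ k)
      x-integral = recip-integral<p k 0<k k≤n
      y-integral = recip[p∸k]-integral<p k 0<k k≤n
    paired : sumFrom1 n g ≡ H⁽³⁾ n + H⁽³⁾ n + ι 3 * ι p * H⁽⁴⁾ n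
    paired = trans (sum-distrib-+ n (λ k → recip³ k + recip³ (p ℕ.∸ k)) (λ k → ι 3 * ι p * recip⁴ k))
      (cong₂ _+_ (trans (sum-distrib-+ n recip³ (λ k → recip³ (p ℕ.∸ k))) (cong (λ t → H⁽³⁾ n + t) (sym (sum-reverse n recip³))))
                 (*-distribˡ-sum n (ι 3 * ι p) recip⁴))
    collect : ∀ a b P → a + a + ι 3 * P * b - ι 3 * (P * b) ≡ ι 2 * a
    collect = solve-∀ ℚ-ring

  -- 1/k + 1/(p-k) + p/k² + p²/k³ + p³/k⁴ = p⁴/(k⁴(p-k)): the truncated expansion of 1/(p-k) in powers of p.
  p⁴∣2H+pH⁽²⁾ : p^ 4 ∣ ι 2 * H n + ι p * H⁽²⁾ n
  p⁴∣2H+pH⁽²⁾ = ∣-respʳ (collect (H n) (H⁽²⁾ n) (H⁽³⁾ n) (H⁽⁴⁾ n) (ι p))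
    (∣-- (∣-- (∣-respʳ paired (∣-sum n _ term-divisible)) (p*-∣ (p*-∣ p²∣H⁽³⁾))) (p*-∣ (p*-∣ (p*-∣ p∣H⁽⁴⁾))))
    where
    P = ι p
    g : ℕ → ℚ
    g k = recip k + recip (p ℕ.∸ k) + P * recip² k + P * (P * recip³ k) + P * (P * (P * recip⁴ k))
    ring-identity : ∀ x y P → (x + y + P * (x * x) + P * (P * (x * x * x)) + P * (P * (P * (x * x * x * x)))) - P * (P * (P * (P * (x * x * x * x * y))))
                            ≡ (1ℚ + P * x + P * P * (x * x) + P * P * P * (x * x * x)) * ((x + y) - P * (x * y))
    ring-identity = solve-∀ ℚ-ring
    term-divisible : ∀ k → 0 ℕ.< k → k ℕ.≤ n → p^ 4 ∣ g k
    term-divisible k 0<k k≤n = ∣-respʳ (sym (linear-combination₁ (1ℚ + P * x + P * P * (x * x) + P * P * P * (x * x * x))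
        (ring-identity x (recip (p ℕ.∸ k)) P) (recip+recip[p∸k] k 0<k k≤n)))
      (p*-∣ (p*-∣ (p*-∣ (p*-∣ (∣-* (recip⁴-integral<p k 0<k k≤n) (recip[p∸k]-integral<p k 0<k k≤n))))))
      where x = recip k
    paired : sumFrom1 n g ≡ H n + H n + P * H⁽²⁾ n + P * (P * H⁽³⁾ n) + P * (P * (P * H⁽⁴⁾ n))
    paired = trans (sum-distrib-+ n _ (λ k → P * (P * (P * recip⁴ k))))
      (cong₂ _+_ (trans (sum-distrib-+ n _ (λ k → P * (P * recip³ k)))
        (cong₂ _+_ (trans (sum-distrib-+ n (λ k → recip k + recip (p ℕ.∸ k)) (λ k → P * recip² k))
          (cong₂ _+_ (trans (sum-distrib-+ n recip (λ k → recip (p ℕ.∸ k))) (cong (λ t → H n + t) (sym (sum-reverse n recip))))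
                     (*-distribˡ-sum n P recip²)))
          (trans (*-distribˡ-sum n P (λ k → P * recip³ k)) (cong (P *_) (*-distribˡ-sum n P recip³)))))
        (trans (*-distribˡ-sum n P (λ k → P * (P * recip⁴ k)))
          (cong (P *_) (trans (*-distribˡ-sum n P (λ k → P * recip⁴ k)) (cong (P *_) (*-distribˡ-sum n P recip⁴))))))
    collect : ∀ a₁ a₂ a₃ a₄ P → a₁ + a₁ + P * a₂ + P * (P * a₃) + P * (P * (P * a₄)) - P * (P * a₃) - P * (P * (P * a₄)) ≡ ι 2 * a₁ + P * a₂
    collect = solve-∀ ℚ-ring

  p²∣H : p^ 2 ∣ H n
  p²∣H = ∣-cancelˡ 2 z<s (<p 2) (∣-respʳ (cancel (H n) (H⁽²⁾ n) (ι p)) (∣-- (∣-≤ (ℕ.s≤s (ℕ.s≤s z≤n)) p⁴∣2H+pH⁽²⁾) (p*-∣ p∣H⁽²⁾)))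
    where
    cancel : ∀ a₁ a₂ P → ι 2 * a₁ + P * a₂ - P * a₂ ≡ ι 2 * a₁
    cancel = solve-∀ ℚ-ring

module HarmonicSums (n : ℕ) (p-prime : Prime (suc n)) (7≤p : 7 ≤ suc n) where

  open Arithmetic
  open BinomialSums
  open import Defs
  open import Data.Nat as ℕ using (ℕ; suc; z≤n; s≤s; z<s)
  import Data.Nat.Properties as ℕ
  open import Data.Nat.Primality using (Prime)
  open import Data.Integer as ℤ using (+_)
  open import Data.Rational as ℚ using (ℚ; 1ℚ; _+_; _*_; _-_; -_; _/_)
  open import Relation.Binary.PropositionalEquality
  open import Tactic.RingSolver using (solve-∀)

  open PowerSums n p-prime 7≤p

  P : ℚ
  P = ι p

  sum-H*recip² sum-H⋆₂*recip² sum-H⁽²⁾*recip² sum-e₂*recip² : ℚ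
  sum-H*recip²    = sumFrom1 n (λ k → H k * recip² k)
  sum-H⋆₂*recip²  = sumFrom1 n (λ k → H⋆₂ k * recip² k)
  sum-H⁽²⁾*recip² = sumFrom1 n (λ k → H⁽²⁾ k * recip² k)
  sum-e₂*recip²   = sumFrom1 n (λ k → e₂ k * recip² k)

  p∣sum-H⋆₂*recip² : p^ 1 ∣ sum-H⋆₂*recip²
  p∣sum-H⋆₂*recip² = ∣-respʳ (sym stuffle)
    (∣-- (p∣binomialSum+sum (λ k → H⁽³⁾ k * recip k) (*-integral<p (λ k _ k≤n → H⁽³⁾-integral k k≤n) recip-integral<p))
         (∣-- (∣-+ (∣-*-integral p∣H (H⁽³⁾-integral n ℕ.≤-refl)) p∣H⁽⁴⁾) p∣sum-H*recip³))
    where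
    B = binomialSum n (λ k → H⁽³⁾ k * recip k)
    S = sumFrom1 n (λ k → H⁽³⁾ k * recip k)
    Z = sumFrom1 n (λ k → H k * recip³ k)
    ring-identity : ∀ y b s a₁₃ a₄ z → y - ((b + s) - (a₁₃ + a₄ - z)) ≡ (- 1ℚ) * (b - y) + (- 1ℚ) * ((s + z) - (a₁₃ + a₄))
    ring-identity = solve-∀ ℚ-ring
    stuffle : sum-H⋆₂*recip² ≡ (B + S) - (H n * H⁽³⁾ n + H⁽⁴⁾ n - Z)
    stuffle = linear-combination₂ (- 1ℚ) (- 1ℚ) (ring-identity sum-H⋆₂*recip² B S (H n * H⁽³⁾ n) (H⁽⁴⁾ n) Z)
      (binomialSum-H⁽³⁾*recip n) (sum-H⁽³⁾*recip+sum-H*recip³ n)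

  p∣sum-H⁽²⁾*recip² : p^ 1 ∣ sum-H⁽²⁾*recip²
  p∣sum-H⁽²⁾*recip² = ∣-cancelˡ 2 z<s (<p 2) (∣-respʳ (sym (sum-H⁽²⁾*recip²-powerSums n))
    (∣-+ (∣-*-integral p∣H⁽²⁾ (H⁽²⁾-integral n ℕ.≤-refl)) p∣H⁽⁴⁾))

  p∣sum-e₂*recip² : p^ 1 ∣ sum-e₂*recip²
  p∣sum-e₂*recip² = ∣-respʳ (sym split) (∣-- p∣sum-H⋆₂*recip² p∣sum-H⁽²⁾*recip²)
    where
    distrib : ∀ a b x → (a - b) * x ≡ a * x - b * x
    distrib = solve-∀ ℚ-ring
    split : sum-e₂*recip² ≡ sum-H⋆₂*recip² - sum-H⁽²⁾*recip²
    split = trans (sum-cong n (λ k _ _ → trans (cong (_* recip² k) (e₂≡H⋆₂-H⁽²⁾ k)) (distrib (H⋆₂ k) (H⁽²⁾ k) (recip² k))))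
      (sum-distrib-- n _ _)

  sum-remainder*recip² : ℚ
  sum-remainder*recip² = sumFrom1 n (λ k → signedBinom-remainder k * recip² k)

  p³∣sum-remainder*recip² : p^ 3 ∣ sum-remainder*recip²
  p³∣sum-remainder*recip² = ∣-sum n _ (λ k 0<k k≤n → ∣-*-integral (p³∣signedBinom-remainder k k≤n) (recip²-integral<p k 0<k k≤n))

  signedSum-recip²-expansion : sumFrom1 n (λ k → signedBinom k * recip² k)
    ≡ sum-remainder*recip² + H⁽²⁾ n - P * sum-H*recip² + P * (P * sum-e₂*recip²)
  signedSum-recip²-expansion = trans (sum-cong n (λ k _ _ → expand (signedBinom k) (H k) (e₂ k) (recip² k) P))
    (trans (sum-distrib-+ n (λ k → r k * recip² k + recip² k - P * (H k * recip² k)) (λ k → P * (P * (e₂ k * recip² k))))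
      (cong₂ _+_ (trans (sum-distrib-- n (λ k → r k * recip² k + recip² k) (λ k → P * (H k * recip² k)))
                   (cong₂ _-_ (sum-distrib-+ n (λ k → r k * recip² k) recip²) (*-distribˡ-sum n P (λ k → H k * recip² k))))
                 (trans (*-distribˡ-sum n P (λ k → P * (e₂ k * recip² k))) (cong (P *_) (*-distribˡ-sum n P (λ k → e₂ k * recip² k))))))
    where
    r = signedBinom-remainder
    expand : ∀ c h e x P → c * x ≡ (c - 1ℚ + P * h - P * P * e) * x + x - P * (h * x) + P * (P * (e * x))
    expand = solve-∀ ℚ-ring

  2p*sum-H*recip²-3H⁽²⁾ : ι 2 * P * sum-H*recip² - ι 3 * H⁽²⁾ n
    ≡ H n * H n + ι 2 * sum-remainder*recip² + ι 2 * (P * (P * sum-e₂*recip²))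
  2p*sum-H*recip²-3H⁽²⁾ = linear-combination₃ (ι 2) (- ι 2) 1ℚ
    (ring-identity P sum-H*recip² (H⁽²⁾ n) (H n) sum-remainder*recip² sum-e₂*recip² X (H⋆₂ n))
    signedSum-recip²-expansion (trans (sym (binomialSum-recip² n)) (binomialSum≡-signedSum recip²)) (H⋆₂-powerSums n)
    where
    X = sumFrom1 n (λ k → signedBinom k * recip² k)
    ring-identity : ∀ P S a₂ a₁ R E X s → ι 2 * P * S - ι 3 * a₂ - (a₁ * a₁ + ι 2 * R + ι 2 * (P * (P * E)))
      ≡ ι 2 * (X - (R + a₂ - P * S + P * (P * E))) + (- ι 2) * (s - (- X)) + 1ℚ * (ι 2 * s - (a₁ * a₁ + a₂))
    ring-identity = solve-∀ ℚ-ring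

  S₁ S₂ S₃ S₄ : ℚ
  S₁ = sumFrom1 n (λ k → H k * inv k 2)
  S₂ = sumFrom1 n (λ k → H k * H k * inv k 1)
  S₃ = (ℤ.- (+ 3)) / 1 * inv p 2 * sumFrom1 n (λ k → inv k 1)
  S₄ = (+ 3) / 2 * inv p 1 * sumFrom1 n (λ k → inv k 2)

  S₁≡sum-H*recip² : S₁ ≡ sum-H*recip²
  S₁≡sum-H*recip² = sum-cong n (λ k _ _ → cong (H k *_) (inv-sq k))

  S₃≡-3H/p² : S₃ ≡ - ι 3 * (recip p * recip p) * H n
  S₃≡-3H/p² = cong (λ t → - ι 3 * t * H n) (inv-sq p)

  S₄≡3H⁽²⁾/2p : S₄ ≡ ι 3 * recip 2 * recip p * H⁽²⁾ n
  S₄≡3H⁽²⁾/2p = cong (λ t → ι 3 * recip 2 * recip p * t) (sum-cong n (λ k _ _ → inv-sq k))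

  p²∣S₁-S₂ : p^ 2 ∣ S₁ - S₂
  p²∣S₁-S₂ = ∣-cancelˡ 3 z<s (<p 3) (∣-respʳ (sym three-times) (∣-- p²∣H⁽³⁾ (∣-*-integral (∣-*-integral p²∣H h) h)))
    where
    h = H-integral n ℕ.≤-refl
    ring-identity : ∀ s₁ s₂ a₃ a₁ → ι 3 * (s₁ - s₂) - (a₃ - a₁ * a₁ * a₁) ≡ (- 1ℚ) * (ι 3 * s₂ - ι 3 * s₁ + a₃ - a₁ * a₁ * a₁)
    ring-identity = solve-∀ ℚ-ring
    three-times : ι 3 * (S₁ - S₂) ≡ H⁽³⁾ n - H n * H n * H n
    three-times = linear-combination₁ (- 1ℚ) (ring-identity S₁ S₂ (H⁽³⁾ n) (H n)) (H-cube n)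

  p²∣S₁-S₄ : p^ 2 ∣ S₁ - S₄
  p²∣S₁-S₄ = ∣-respʳ (sym (trans (cong₂ _-_ S₁≡sum-H*recip² S₄≡3H⁽²⁾/2p) scaled))
    (∣-* (recip-integral z<s (<p 2)) (∣-*recip-p (∣-respʳ (sym 2p*sum-H*recip²-3H⁽²⁾)
      (∣-+ (∣-+ (∣-≤ (s≤s (s≤s (s≤s z≤n))) (∣-* p²∣H p²∣H)) (∣-* (ι-integral 2) p³∣sum-remainder*recip²))
           (∣-* (ι-integral 2) (p*-∣ (p*-∣ p∣sum-e₂*recip²)))))))
    where
    S = sum-H*recip²
    ring-identity : ∀ S h y P a₂ → S - ι 3 * h * y * a₂ - h * ((ι 2 * P * S - ι 3 * a₂) * y)
      ≡ (- (S * (y * P))) * (h * ι 2 - 1ℚ) + (- S) * (y * P - 1ℚ)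
    ring-identity = solve-∀ ℚ-ring
    scaled : S - ι 3 * recip 2 * recip p * H⁽²⁾ n ≡ recip 2 * ((ι 2 * P * S - ι 3 * H⁽²⁾ n) * recip p)
    scaled = linear-combination₂ (- (S * (recip p * P))) (- S) (ring-identity S (recip 2) (recip p) P (H⁽²⁾ n))
      (recip-inverseˡ 2 z<s) (recip-inverseˡ p z<s)

  p²∣S₃-S₄ : p^ 2 ∣ S₃ - S₄
  p²∣S₃-S₄ = ∣-respʳ (sym (trans (cong₂ _-_ S₃≡-3H/p² S₄≡3H⁽²⁾/2p) scaled))
    (∣-neg (∣-* (∣-* (ι-integral 3) (recip-integral z<s (<p 2))) (∣-*recip-p (∣-*recip-p p⁴∣2H+pH⁽²⁾))))
    where
    W = ι 2 * H n + P * H⁽²⁾ n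
    ring-identity : ∀ y h a₁ a₂ P → (- ι 3 * (y * y) * a₁ - ι 3 * h * y * a₂) - (- (ι 3 * h * ((ι 2 * a₁ + P * a₂) * y * y)))
      ≡ (ι 3 * (y * y) * a₁) * (h * ι 2 - 1ℚ) + (ι 3 * h * y * a₂) * (y * P - 1ℚ)
    ring-identity = solve-∀ ℚ-ring
    scaled : - ι 3 * (recip p * recip p) * H n - ι 3 * recip 2 * recip p * H⁽²⁾ n ≡ - (ι 3 * recip 2 * (W * recip p * recip p))
    scaled = linear-combination₂ (ι 3 * (recip p * recip p) * H n) (ι 3 * recip 2 * recip p * H⁽²⁾ n)
      (ring-identity (recip p) (recip 2) (H n) (H⁽²⁾ n) P) (recip-inverseˡ 2 z<s) (recip-inverseˡ p z<s)

  p²∣S₂-S₃ : p^ 2 ∣ S₂ - S₃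
  p²∣S₂-S₃ = ∣-respʳ (telescope S₁ S₂ S₃ S₄) (∣-+ (∣-+ (∣-neg p²∣S₁-S₂) p²∣S₁-S₄) (∣-neg p²∣S₃-S₄))
    where
    telescope : ∀ a b c d → - (a - b) + (a - d) + - (c - d) ≡ b - c
    telescope = solve-∀ ℚ-ring

  S₁-integral : p^ 0 ∣ S₁
  S₁-integral = ∣-respʳ (sym S₁≡sum-H*recip²) (∣-sum n _ (*-integral<p (λ k _ k≤n → H-integral k k≤n) recip²-integral<p))

  S₂-integral : p^ 0 ∣ S₂
  S₂-integral = ∣-sum n _ (*-integral<p (*-integral<p h h) recip-integral<p)
    where
    h : Integral<p H
    h k _ k≤n = H-integral k k≤n

  S₃-integral : p^ 0 ∣ S₃
  S₃-integral = ∣-respʳ (trans (rearrange (H n) (recip p)) (sym S₃≡-3H/p²)) (∣-* (∣-neg (ι-integral 3)) (∣-*recip-p (∣-*recip-p p²∣H)))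
    where
    rearrange : ∀ a y → - ι 3 * (a * y * y) ≡ - ι 3 * (y * y) * a
    rearrange = solve-∀ ℚ-ring

  S₄-integral : p^ 0 ∣ S₄
  S₄-integral = ∣-respʳ (trans (rearrange (H⁽²⁾ n) (recip 2) (recip p)) (sym S₄≡3H⁽²⁾/2p))
    (∣-* (∣-* (ι-integral 3) (recip-integral z<s (<p 2))) (∣-*recip-p p∣H⁽²⁾))
    where
    rearrange : ∀ a h y → ι 3 * h * (a * y) ≡ ι 3 * h * y * a
    rearrange = solve-∀ ℚ-ring

open import Defs
open import Data.Nat using (ℕ; _≤_; _∸_)
open import Data.Nat.Primality using (Prime)
open import Data.Integer using (+_; -_)
open import Data.Rational using (ℚ; _/_; _*_)
open import Data.Product using (_×_)
open import Data.Product using (_,_)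

theorem1p1 : (p : ℕ) → Prime p → 7 ≤ p →
  let S1 = sumFrom1 (p ∸ 1) (λ k → H k * inv k 2)
      S2 = sumFrom1 (p ∸ 1) (λ k → H k * H k * inv k 1)
      S3 = (- (+ 3)) / 1 * inv p 2 * sumFrom1 (p ∸ 1) (λ k → inv k 1)
      S4 = (+ 3) / 2 * inv p 1 * sumFrom1 (p ∸ 1) (λ k → inv k 2)
  in (S1 ≡ S2 [mod p ^ 2 ]) × (S2 ≡ S3 [mod p ^ 2 ]) × (S3 ≡ S4 [mod p ^ 2 ])
theorem1p1 0       _       ()
theorem1p1 (suc n) p-prime 7≤p =
  ∣⇒≡[mod] S₁-integral S₂-integral p²∣S₁-S₂ ,
  ∣⇒≡[mod] S₂-integral S₃-integral p²∣S₂-S₃ ,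
  ∣⇒≡[mod] S₃-integral S₄-integral p²∣S₃-S₄
  where
  open PowerSums n p-prime 7≤p
  open HarmonicSums n p-prime 7≤p
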